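{- Let $(n,k,l)\in\mathbb{N}^3$ with $2\le k-l$, and let $m\in\mathbb{Z}^+$ satisfy $k-l\le 2^m<2(k-l)$. If $2^m\le n$, then \[{\rm Nim}(\mathcal{KG}(n,k,l))={\rm Nim}\big(\mathcal{KG}(n-2^m,k,l)+\mathcal{KG}(n-2^m,k-2^m,l-2^m)\big).\]
   Context: Chomp on a finite poset $P$ with global minimum $0$: two players alternately pick an element $x$ of the remaining poset and remove all elements $\ge x$; the player forced to pick $0$ loses. ${\rm Nim}(\{0\})=0$ and ${\rm Nim}(P)=\mathrm{mex}\{{\rm Nim}(P_x) : x\in P\setminus\{0\}\}$, where $P_x$ is $P$ with the up-set of $x$ removed. A finite graph is regarded as the poset of the empty set, its vertices and its edges ordered by inclusion. For $(n,k,l)\in\mathbb{N}\times\mathbb{Z}^2$, $\mathcal{KG}(n,k,l)$ has as vertices the $k$-element subsets of $\{1,\dots,n\}$ (no vertices if $k<0$ or $k>n$), two distinct vertices adjacent iff the sets intersect in at most $l$ elements. The join $G_1+G_2$ of two graphs (on disjoint vertex sets) is their disjoint union together with all edges between a vertex of $G_1$ and a vertex of $G_2$. -}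

module Defs where

open import Data.Nat using (ℕ; zero; suc; _+_; _≤?_)
open import Data.Integer as ℤ using (ℤ; +_)
open import Data.Bool using (Bool; true; false; if_then_else_; _∨_)
open import Data.List using (List; []; _∷_; map; filter; length; _++_; concatMap)
open import Data.List.Membership.DecPropositional (Data.Nat._≟_) using (_∈?_)
open import Data.Product using (_×_; _,_; proj₁; proj₂)
open import Data.Sum using (_⊎_; inj₁; inj₂)
open import Data.Sum.Properties using (≡-dec)
open import Data.Vec using (Vec; []; _∷_)
import Data.Vec.Properties as VecP
open import Data.Fin.Subset using (Subset; ∣_∣; _∩_)
open import Relation.Binary.Definitions using (DecidableEquality)
open import Relation.Nullary using (does; ¬_)
open import Relation.Nullary.Decidable using (⌊_⌋)

-- Finite (simple) graphs, given by a vertex list and an edge list.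
-- The associated poset is {∅} ∪ vertices ∪ edges ordered by inclusion.

record Graph : Set₁ where
  field
    Vtx      : Set
    _≟V_     : DecidableEquality Vtx
    vertices : List Vtx
    edges    : List (Vtx × Vtx)
open Graph public

mexFrom : ℕ → ℕ → List ℕ → ℕ
mexFrom zero    n xs = n
mexFrom (suc f) n xs = if does (n ∈? xs) then mexFrom f (suc n) xs else n

mex : List ℕ → ℕ
mex xs = mexFrom (length xs) 0 xs

picks : {A : Set} → List A → List (A × List A)
picks []       = []
picks (x ∷ xs) = (x , xs) ∷ map (λ p → proj₁ p , x ∷ proj₂ p) (picks xs)

-- Chomp on the poset of a graph.  A position is a subgraph (W, F).
-- Picking a vertex v removes the up-set {v} ∪ {edges containing v};
-- picking an edge e removes just e.  Picking ∅ (losing) is not a move.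
-- nimF is fuel-bounded; every move decreases |W| + |F| by at least one,
-- so fuel |W| + |F| + 1 is always sufficient.

module _ {V : Set} (_≟_ : DecidableEquality V) where
  incident : V → V × V → Bool
  incident v (a , b) = ⌊ v ≟ a ⌋ ∨ ⌊ v ≟ b ⌋

  notIncident : V → V × V → Bool
  notIncident v e = if incident v e then false else true

  nimF : ℕ → List V → List (V × V) → ℕ
  nimF zero    vs es = 0
  nimF (suc f) vs es =
    mex ( map (λ p → nimF f (proj₂ p)
                        (Data.List.filter (λ e → Data.Bool._≟_ (notIncident (proj₁ p) e) true) es))
              (picks vs)
       ++ map (λ p → nimF f vs (proj₂ p)) (picks es) )

Nim : Graph → ℕ
Nim G = nimF (_≟V_ G) (suc (length (vertices G) + length (edges G))) (vertices G) (edges G)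

pairsWith : {A B : Set} → List A → List B → List (A × B)
pairsWith as bs = concatMap (λ a → map (a ,_) bs) as

join : Graph → Graph → Graph
join G H = record
  { Vtx      = Vtx G ⊎ Vtx H
  ; _≟V_     = ≡-dec (_≟V_ G) (_≟V_ H)
  ; vertices = map inj₁ (vertices G) ++ map inj₂ (vertices H)
  ; edges    = map (λ e → inj₁ (proj₁ e) , inj₁ (proj₂ e)) (edges G)
            ++ map (λ e → inj₂ (proj₁ e) , inj₂ (proj₂ e)) (edges H)
            ++ map (λ p → inj₁ (proj₁ p) , inj₂ (proj₂ p)) (pairsWith (vertices G) (vertices H))
  }

infixl 6 _+G_
_+G_ : Graph → Graph → Graph
_+G_ = join

allSubsets : (n : ℕ) → List (Subset n)
allSubsets zero    = [] ∷ []
allSubsets (suc n) = map (false ∷_) (allSubsets n) ++ map (true ∷_) (allSubsets n)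

pairs : {A : Set} → List A → List (A × A)
pairs []       = []
pairs (x ∷ xs) = map (x ,_) xs ++ pairs xs

KGverts : (n : ℕ) → ℤ → List (Subset n)
KGverts n k = filter (λ s → (+ ∣ s ∣) ℤ.≟ k) (allSubsets n)

KG : ℕ → ℤ → ℤ → Graph
KG n k l = record
  { Vtx      = Subset n
  ; _≟V_     = VecP.≡-dec Data.Bool._≟_
  ; vertices = KGverts n k
  ; edges    = filter (λ e → (+ ∣ proj₁ e ∩ proj₂ e ∣) ℤ.≤? l) (pairs (KGverts n k))
  }

module Submission where

-- Chomp on a graph only depends on the graph up to isomorphism.  If an involution σ of a graph
-- never maps a vertex to a distinct neighbour, its Nim-value equals that of the subgraph fixed
-- by σ: a move outside the fixed part can be answered by its mirror image, which restores a
-- position with the same fixed part.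
--
-- Split {1,…,n} into a block of 2^m elements and the remaining n − 2^m, and more generally let
-- the block consist of r elements of weight w, adjacency meaning common weight ≤ l.  For
-- w r + l < k, swapping the two halves of a block of size 2r is such an involution, and its
-- fixed subgraph is the same kind of graph for a block of r elements of weight 2w.  After m
-- halvings the block is one element of weight 2^m; the k-sets avoiding it form KG(n−2^m,k,l),
-- those containing it form KG(n−2^m,k−2^m,l−2^m), and since k − l ≤ 2^m every vertex of the
-- second kind is adjacent to every vertex of the first kind.

open import Defs
open import Level using (0ℓ)
open import Data.Nat using (ℕ; zero; suc; _+_; _*_; _∸_; _^_; _≤_; _<_; _≟_; _≤?_; z≤n; s≤s; s≤s⁻¹)
open import Data.Nat.Properties
open import Data.Nat.Solver using (module +-*-Solver)
open +-*-Solver using (solve; _:+_; _:*_; _:=_; con)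
open import Data.Bool using (Bool; true; false; if_then_else_; _∨_; _∧_)
import Data.Bool as Bool
open import Data.Bool.Properties using (∨-comm)
open import Data.Integer as ℤ using (ℤ; +_; +≤+; _-_)
import Data.Integer.Properties as ℤ
open import Data.Vec using (Vec; []; _∷_; take; drop; splitAt) renaming (_++_ to _++ᵛ_)
import Data.Vec.Properties as Vec
open import Data.Fin.Subset using (Subset; ∣_∣; _∩_)
open import Data.Fin.Subset.Properties using (∩-comm; ∩-idem; ∣p∩q∣≤∣q∣)
open import Data.List using (List; []; _∷_; length; _++_; map; filter; cartesianProduct)
open import Data.List.Properties using (length-++; length-map; map-∘; map-cong; map-cong-local; length-filter; filter-accept; filter-reject; filter-all)
open import Data.List.Membership.Propositional using (_∈_; _∉_)
open import Data.List.Membership.Propositional.Properties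
  using (∈-∃++; ∈-++⁻; ∈-++⁺ˡ; ∈-++⁺ʳ; ∈-map⁺; ∈-map⁻; ∈-filter⁺; ∈-filter⁻; ∈-cartesianProduct⁺; ∈-cartesianProduct⁻)
open import Data.List.Membership.Propositional.Properties.WithK using (unique∧set⇒bag)
open import Data.List.Membership.DecPropositional (Data.Nat._≟_) using (_∈?_)
open import Data.List.Relation.Unary.Any using (here; there)
import Data.List.Relation.Unary.All as All
open import Data.List.Relation.Unary.AllPairs using (AllPairs; []; _∷_)
import Data.List.Relation.Unary.AllPairs as AllPairs
import Data.List.Relation.Unary.AllPairs.Properties as AllPairs
open import Data.List.Relation.Unary.Unique.Propositional using (Unique)
import Data.List.Relation.Unary.Unique.Propositional.Properties as Unique
open import Data.List.Relation.Binary.Subset.Propositional using (_⊆_)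
open import Data.List.Relation.Binary.Permutation.Propositional using (_↭_; ↭-refl; ↭-sym; ↭-trans; ↭-prep; ↭-swap; ↭-reflexive)
open import Data.List.Relation.Binary.Permutation.Propositional.Properties using (∈-resp-↭; drop-∷; filter-↭; ↭-length; map⁺)
open import Data.List.Relation.Binary.BagAndSetEquality using (∼bag⇒↭)
open import Data.Product as Prod using (_×_; _,_; proj₁; proj₂; Σ-syntax)
open import Data.Product.Properties using (,-injective; ≡-dec)
open import Data.Product.Relation.Binary.Lex.Strict using (×-Lex; ×-isStrictTotalOrder)
open import Data.Product.Relation.Binary.Pointwise.NonDependent using (≡×≡⇒≡)
open import Data.Sum as Sum using (_⊎_; inj₁; inj₂; [_,_]′)
import Data.Sum.Properties as Sum
open import Data.Empty using (⊥; ⊥-elim)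
open import Data.Unit using (⊤; tt)
open import Function using (_∘_)
open import Function.Bundles using (_⇔_; mk⇔)
open import Relation.Nullary using (yes; no; ¬_; does; Dec)
open import Relation.Nullary.Decidable using (⌊_⌋; does-⇔; isYes≗does)
open import Relation.Binary.Core using (Rel)
open import Relation.Binary.Structures using (IsStrictTotalOrder)
open import Relation.Binary.Definitions using (DecidableEquality; Trichotomous; Tri; tri<; tri≈; tri>)
open import Relation.Binary.PropositionalEquality
import Relation.Unary as U

mexFrom-covers : ∀ f n xs → (∀ u → u < n → u ∈ xs) →
  (∀ u → u < mexFrom f n xs → u ∈ xs) × (mexFrom f n xs ∉ xs ⊎ mexFrom f n xs ≡ n + f)
mexFrom-covers zero n xs below = below , inj₂ (sym (+-identityʳ n))
mexFrom-covers (suc f) n xs below with n ∈? xs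
... | no n∉xs = below , inj₁ n∉xs
... | yes n∈xs =
  Prod.map₂ (Sum.map₂ (λ e → trans e (sym (+-suc n f)))) (mexFrom-covers f (suc n) xs below′)
  where
  below′ : ∀ u → u < suc n → u ∈ xs
  below′ u u<1+n with m≤n⇒m<n∨m≡n (s≤s⁻¹ u<1+n)
  ... | inj₁ u<n = below u u<n
  ... | inj₂ refl = n∈xs

covered⇒≤length : ∀ n xs → (∀ u → u < n → u ∈ xs) → n ≤ length xs
covered⇒≤length zero xs covered = z≤n
covered⇒≤length (suc n) xs covered with ∈-∃++ (covered n ≤-refl)
... | ys , zs , refl =
  subst (suc n ≤_) (sym length-split) (s≤s (covered⇒≤length n (ys ++ zs) covered′))
  where
  length-split : length (ys ++ n ∷ zs) ≡ suc (length (ys ++ zs))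
  length-split = trans (length-++ ys) (trans (+-suc (length ys) (length zs)) (cong suc (sym (length-++ ys))))
  covered′ : ∀ u → u < n → u ∈ ys ++ zs
  covered′ u u<n with ∈-++⁻ ys (covered u (m<n⇒m<1+n u<n))
  ... | inj₁ u∈ys = ∈-++⁺ˡ u∈ys
  ... | inj₂ (here refl) = ⊥-elim (<-irrefl refl u<n)
  ... | inj₂ (there u∈zs) = ∈-++⁺ʳ ys u∈zs

<mex⇒∈ : ∀ xs u → u < mex xs → u ∈ xs
<mex⇒∈ xs = proj₁ (mexFrom-covers (length xs) 0 xs (λ u ()))

-- If the search ran out of fuel, xs would contain all of 0, …, length xs.
mex∉ : ∀ xs → mex xs ∉ xs
mex∉ xs mex∈xs with proj₂ (mexFrom-covers (length xs) 0 xs (λ u ()))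
... | inj₁ mex∉xs = mex∉xs mex∈xs
... | inj₂ mex≡length = <-irrefl refl (covered⇒≤length (suc (length xs)) xs covered)
  where
  covered : ∀ u → u < suc (length xs) → u ∈ xs
  covered u u<1+len with m≤n⇒m<n∨m≡n (s≤s⁻¹ u<1+len)
  ... | inj₁ u<len = <mex⇒∈ xs u (subst (u <_) (sym mex≡length) u<len)
  ... | inj₂ refl = subst (_∈ xs) mex≡length mex∈xs

mex-unique : ∀ xs v → v ∉ xs → (∀ u → u < v → u ∈ xs) → mex xs ≡ v
mex-unique xs v v∉xs below with <-cmp (mex xs) v
... | tri< mex<v _ _ = ⊥-elim (mex∉ xs (below _ mex<v))
... | tri≈ _ mex≡v _ = mex≡v
... | tri> _ _ v<mex = ⊥-elim (v∉xs (<mex⇒∈ xs v v<mex))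

mex-cong : ∀ {xs ys} → xs ⊆ ys → ys ⊆ xs → mex xs ≡ mex ys
mex-cong {xs} {ys} xs⊆ys ys⊆xs =
  sym (mex-unique ys (mex xs) (λ mex∈ys → mex∉ xs (ys⊆xs mex∈ys)) (λ u u<mex → xs⊆ys (<mex⇒∈ xs u u<mex)))

module _ {A : Set} where

  picks⇒↭ : ∀ {x r} (xs : List A) → (x , r) ∈ picks xs → xs ↭ x ∷ r
  picks⇒↭ (y ∷ ys) (here refl) = ↭-refl
  picks⇒↭ (y ∷ ys) (there p) with ∈-map⁻ _ p
  ... | (x , r) , q , refl = ↭-trans (↭-prep y (picks⇒↭ ys q)) (↭-swap y x ↭-refl)

  ∈⇒picks : ∀ {x} (xs : List A) → x ∈ xs → Σ[ r ∈ List A ] (x , r) ∈ picks xs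
  ∈⇒picks (y ∷ ys) (here refl) = ys , here refl
  ∈⇒picks (y ∷ ys) (there x∈ys) with ∈⇒picks ys x∈ys
  ... | r , q = y ∷ r , there (∈-map⁺ (λ p → proj₁ p , y ∷ proj₂ p) q)

  picks-length : ∀ {x r} (xs : List A) → (x , r) ∈ picks xs → length xs ≡ suc (length r)
  picks-length xs p = ↭-length (picks⇒↭ xs p)

  picks-map : {B : Set} (f : A → B) (xs : List A) → picks (map f xs) ≡ map (Prod.map f (map f)) (picks xs)
  picks-map f [] = refl
  picks-map f (y ∷ ys) = cong ((f y , map f ys) ∷_) (begin
      map (λ p → proj₁ p , f y ∷ proj₂ p) (picks (map f ys))
    ≡⟨ cong (map _) (picks-map f ys) ⟩
      map (λ p → proj₁ p , f y ∷ proj₂ p) (map (Prod.map f (map f)) (picks ys))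
    ≡⟨ sym (map-∘ (picks ys)) ⟩
      map (λ p → f (proj₁ p) , f y ∷ map f (proj₂ p)) (picks ys)
    ≡⟨ map-∘ (picks ys) ⟩
      map (Prod.map f (map f)) (map (λ p → proj₁ p , y ∷ proj₂ p) (picks ys)) ∎)
    where open ≡-Reasoning

  filter-map : {B : Set} {P : B → Set} {Q : A → Set} (P? : U.Decidable P) (Q? : U.Decidable Q) (f : A → B) →
    (∀ x → does (P? (f x)) ≡ does (Q? x)) → ∀ xs → filter P? (map f xs) ≡ map f (filter Q? xs)
  filter-map P? Q? f agree [] = refl
  filter-map P? Q? f agree (x ∷ xs) with does (P? (f x)) | does (Q? x) | agree x
  ... | true  | true  | _ = cong (f x ∷_) (filter-map P? Q? f agree xs)
  ... | false | false | _ = filter-map P? Q? f agree xs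

  filter-comm : {P Q : A → Set} (P? : U.Decidable P) (Q? : U.Decidable Q) (xs : List A) →
    filter P? (filter Q? xs) ≡ filter Q? (filter P? xs)
  filter-comm P? Q? [] = refl
  filter-comm {P} {Q} P? Q? (x ∷ xs) = by-cases (P? x) (Q? x)
    where
    open ≡-Reasoning
    ih = filter-comm P? Q? xs
    by-cases : Dec (P x) → Dec (Q x) → filter P? (filter Q? (x ∷ xs)) ≡ filter Q? (filter P? (x ∷ xs))
    by-cases (yes p) (yes q) = begin
      filter P? (filter Q? (x ∷ xs)) ≡⟨ cong (filter P?) (filter-accept Q? q) ⟩
      filter P? (x ∷ filter Q? xs)   ≡⟨ filter-accept P? p ⟩
      x ∷ filter P? (filter Q? xs)   ≡⟨ cong (x ∷_) ih ⟩
      x ∷ filter Q? (filter P? xs)   ≡⟨ filter-accept Q? q ⟨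
      filter Q? (x ∷ filter P? xs)   ≡⟨ cong (filter Q?) (filter-accept P? p) ⟨
      filter Q? (filter P? (x ∷ xs)) ∎
    by-cases (yes p) (no ¬q) = begin
      filter P? (filter Q? (x ∷ xs)) ≡⟨ cong (filter P?) (filter-reject Q? ¬q) ⟩
      filter P? (filter Q? xs)       ≡⟨ ih ⟩
      filter Q? (filter P? xs)       ≡⟨ filter-reject Q? ¬q ⟨
      filter Q? (x ∷ filter P? xs)   ≡⟨ cong (filter Q?) (filter-accept P? p) ⟨
      filter Q? (filter P? (x ∷ xs)) ∎
    by-cases (no ¬p) (yes q) = begin
      filter P? (filter Q? (x ∷ xs)) ≡⟨ cong (filter P?) (filter-accept Q? q) ⟩
      filter P? (x ∷ filter Q? xs)   ≡⟨ filter-reject P? ¬p ⟩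
      filter P? (filter Q? xs)       ≡⟨ ih ⟩
      filter Q? (filter P? xs)       ≡⟨ cong (filter Q?) (filter-reject P? ¬p) ⟨
      filter Q? (filter P? (x ∷ xs)) ∎
    by-cases (no ¬p) (no ¬q) = begin
      filter P? (filter Q? (x ∷ xs)) ≡⟨ cong (filter P?) (filter-reject Q? ¬q) ⟩
      filter P? (filter Q? xs)       ≡⟨ ih ⟩
      filter Q? (filter P? xs)       ≡⟨ cong (filter Q?) (filter-reject P? ¬p) ⟨
      filter Q? (filter P? (x ∷ xs)) ∎

  ↭∷⇒head∈ : ∀ {xs : List A} {x r} → xs ↭ x ∷ r → x ∈ xs
  ↭∷⇒head∈ p = ∈-resp-↭ (↭-sym p) (here refl)

  ↭∷⇒tail⊆ : ∀ {xs : List A} {x r} → xs ↭ x ∷ r → r ⊆ xs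
  ↭∷⇒tail⊆ p y∈r = ∈-resp-↭ (↭-sym p) (there y∈r)

  ↭∷⇒∈tail : ∀ {xs : List A} {x y r} → xs ↭ x ∷ r → y ∈ xs → y ≢ x → y ∈ r
  ↭∷⇒∈tail p y∈xs y≢x with ∈-resp-↭ p y∈xs
  ... | here y≡x = ⊥-elim (y≢x y≡x)
  ... | there y∈r = y∈r

  Permutes : (A → A) → List A → Set
  Permutes f xs = xs ↭ map f xs

  Permutes⇒∈ : ∀ {f xs x} → Permutes f xs → x ∈ xs → f x ∈ xs
  Permutes⇒∈ {f} perm x∈xs = ∈-resp-↭ (↭-sym perm) (∈-map⁺ f x∈xs)

  Permutes-remove-fixed : ∀ {f xs x r} → Permutes f xs → xs ↭ x ∷ r → f x ≡ x → Permutes f r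
  Permutes-remove-fixed {f} {xs} {x} {r} perm p fx≡x =
    drop-∷ (↭-trans (↭-sym p) (↭-trans perm (subst (λ z → map f xs ↭ z ∷ map f r) fx≡x (map⁺ f p))))

  Permutes-remove-swap : ∀ {f xs x y r r′} → Permutes f xs → xs ↭ x ∷ r → r ↭ y ∷ r′ →
    f x ≡ y → f y ≡ x → Permutes f r′
  Permutes-remove-swap {f} {xs} {x} {y} {r} {r′} perm p q fx≡y fy≡x =
    drop-∷ (drop-∷ (↭-trans (↭-trans (↭-sym p′) (↭-trans perm
      (subst₂ (λ a b → map f xs ↭ a ∷ b ∷ map f r′) fx≡y fy≡x (map⁺ f p′)))) (↭-swap y x ↭-refl)))
    where
    p′ : xs ↭ x ∷ y ∷ r′
    p′ = ↭-trans p (↭-prep x q)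

⌊⌋-⇔ : {A B : Set} → A ⇔ B → (a? : Dec A) (b? : Dec B) → ⌊ a? ⌋ ≡ ⌊ b? ⌋
⌊⌋-⇔ A⇔B a? b? = trans (isYes≗does a?) (trans (does-⇔ A⇔B a? b?) (sym (isYes≗does b?)))

module _ {V W : Set} (_≟V_ : DecidableEquality V) (_≟W_ : DecidableEquality W) where

  incident-map : (ψ : V → W) → (∀ {x y} → ψ x ≡ ψ y → x ≡ y) →
    ∀ v a b → incident _≟W_ (ψ v) (ψ a , ψ b) ≡ incident _≟V_ v (a , b)
  incident-map ψ ψ-injective v a b =
    cong₂ _∨_ (⌊⌋-⇔ (mk⇔ ψ-injective (cong ψ)) (ψ v ≟W ψ a) (v ≟V a))
              (⌊⌋-⇔ (mk⇔ ψ-injective (cong ψ)) (ψ v ≟W ψ b) (v ≟V b))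

incident-swap : ∀ {V : Set} (_≟_ : DecidableEquality V) v a b → incident _≟_ v (b , a) ≡ incident _≟_ v (a , b)
incident-swap _≟_ v a b = ∨-comm ⌊ v ≟ b ⌋ ⌊ v ≟ a ⌋

incident-≢ : ∀ {V : Set} (_≟_ : DecidableEquality V) {v a b} → v ≢ a → v ≢ b → incident _≟_ v (a , b) ≡ false
incident-≢ _≟_ {v} {a} {b} v≢a v≢b with v ≟ a | v ≟ b
... | yes v≡a | _ = ⊥-elim (v≢a v≡a)
... | no _ | yes v≡b = ⊥-elim (v≢b v≡b)
... | no _ | no _ = refl

module Chomp {V : Set} (_≟_ : DecidableEquality V) where

  Edge : Set
  Edge = V × V

  deleteVertex : V → List Edge → List Edge
  deleteVertex v = filter (λ e → notIncident _≟_ v e Bool.≟ true)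

  size : List V → List Edge → ℕ
  size vs es = length vs + length es

  nim : List V → List Edge → ℕ
  nim vs es = nimF _≟_ (suc (size vs es)) vs es

  options : List V → List Edge → List ℕ
  options vs es = map (λ p → nim (proj₂ p) (deleteVertex (proj₁ p) es)) (picks vs)
               ++ map (λ p → nim vs (proj₂ p)) (picks es)

  size-vertexMove< : ∀ {v r} vs es → (v , r) ∈ picks vs → size r (deleteVertex v es) < size vs es
  size-vertexMove< {v} {r} vs es p rewrite picks-length vs p = s≤s (+-monoʳ-≤ (length r) (length-filter _ es))

  size-edgeMove< : ∀ {e r} vs es → (e , r) ∈ picks es → size vs r < size vs es
  size-edgeMove< {e} {r} vs es p rewrite picks-length es p | +-suc (length vs) (length r) = ≤-refl

  nimF-fuel : ∀ f g vs es → size vs es < f → size vs es < g → nimF _≟_ f vs es ≡ nimF _≟_ g vs es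
  nimF-fuel (suc f) (suc g) vs es (s≤s a) (s≤s b) = cong mex (cong₂ _++_
    (map-cong-local (All.tabulate λ q →
      nimF-fuel f g _ _ (≤-trans (size-vertexMove< vs es q) a) (≤-trans (size-vertexMove< vs es q) b)))
    (map-cong-local (All.tabulate λ q →
      nimF-fuel f g _ _ (≤-trans (size-edgeMove< vs es q) a) (≤-trans (size-edgeMove< vs es q) b))))

  nim≡mex-options : ∀ vs es → nim vs es ≡ mex (options vs es)
  nim≡mex-options vs es = cong mex (cong₂ _++_
    (map-cong-local (All.tabulate λ q → nimF-fuel _ _ _ _ (size-vertexMove< vs es q) ≤-refl))
    (map-cong-local (All.tabulate λ q → nimF-fuel _ _ _ _ (size-edgeMove< vs es q) ≤-refl)))

  vertexMove∈options : ∀ {v r} vs es → (v , r) ∈ picks vs → nim r (deleteVertex v es) ∈ options vs es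
  vertexMove∈options vs es p = ∈-++⁺ˡ (∈-map⁺ (λ p → nim (proj₂ p) (deleteVertex (proj₁ p) es)) p)

  edgeMove∈options : ∀ {e r} vs es → (e , r) ∈ picks es → nim vs r ∈ options vs es
  edgeMove∈options vs es p = ∈-++⁺ʳ _ (∈-map⁺ (λ p → nim vs (proj₂ p)) p)

  data Option (u : ℕ) (vs : List V) (es : List Edge) : Set where
    vertexMove : ∀ {v r} → (v , r) ∈ picks vs → u ≡ nim r (deleteVertex v es) → Option u vs es
    edgeMove   : ∀ {e r} → (e , r) ∈ picks es → u ≡ nim vs r → Option u vs es

  options⁻ : ∀ {u} vs es → u ∈ options vs es → Option u vs es
  options⁻ vs es u∈ with ∈-++⁻ (map (λ p → nim (proj₂ p) (deleteVertex (proj₁ p) es)) (picks vs)) u∈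
  ... | inj₁ q with ∈-map⁻ _ q
  ...   | _ , p , u≡ = vertexMove p u≡
  options⁻ vs es u∈ | inj₂ q with ∈-map⁻ _ q
  ...   | _ , p , u≡ = edgeMove p u≡

  nim∉options : ∀ vs es → nim vs es ∉ options vs es
  nim∉options vs es nim∈ = mex∉ (options vs es) (subst (_∈ options vs es) (nim≡mex-options vs es) nim∈)

  <nim⇒∈options : ∀ vs es u → u < nim vs es → u ∈ options vs es
  <nim⇒∈options vs es u u<nim = <mex⇒∈ (options vs es) u (subst (u <_) (nim≡mex-options vs es) u<nim)

  nim-unique : ∀ vs es g → g ∉ options vs es → (∀ u → u < g → u ∈ options vs es) → nim vs es ≡ g
  nim-unique vs es g g∉ below = trans (nim≡mex-options vs es) (mex-unique _ g g∉ below)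

  vertexMove≢nim : ∀ {v r} vs es → (v , r) ∈ picks vs → nim r (deleteVertex v es) ≢ nim vs es
  vertexMove≢nim vs es p eq = nim∉options vs es (subst (_∈ options vs es) eq (vertexMove∈options vs es p))

  edgeMove≢nim : ∀ {e r} vs es → (e , r) ∈ picks es → nim vs r ≢ nim vs es
  edgeMove≢nim vs es p eq = nim∉options vs es (subst (_∈ options vs es) eq (edgeMove∈options vs es p))

  private
    options-resp-↭ : ∀ b vs vs′ es es′ → size vs es ≤ b → vs ↭ vs′ → es ↭ es′ →
      (∀ {vs vs′ es es′} → size vs es < b → vs ↭ vs′ → es ↭ es′ → nim vs es ≡ nim vs′ es′) →
      options vs es ⊆ options vs′ es′
    options-resp-↭ b vs vs′ es es′ bound pv pe ih u∈ with options⁻ vs es u∈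
    ... | vertexMove {v} {r} p refl =
      let (r′ , p′) = ∈⇒picks vs′ (∈-resp-↭ pv (↭∷⇒head∈ (picks⇒↭ vs p)))
          r↭r′ = drop-∷ (↭-trans (↭-sym (picks⇒↭ vs p)) (↭-trans pv (picks⇒↭ vs′ p′)))
      in subst (_∈ options vs′ es′)
           (sym (ih (≤-trans (size-vertexMove< vs es p) bound) r↭r′ (filter-↭ _ pe)))
           (vertexMove∈options vs′ es′ p′)
    ... | edgeMove {e} {r} p refl =
      let (r′ , p′) = ∈⇒picks es′ (∈-resp-↭ pe (↭∷⇒head∈ (picks⇒↭ es p)))
          r↭r′ = drop-∷ (↭-trans (↭-sym (picks⇒↭ es p)) (↭-trans pe (picks⇒↭ es′ p′)))
      in subst (_∈ options vs′ es′)
           (sym (ih (≤-trans (size-edgeMove< vs es p) bound) pv r↭r′))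
           (edgeMove∈options vs′ es′ p′)

    nim-resp-↭-bounded : ∀ b {vs vs′ es es′} → size vs es < b → vs ↭ vs′ → es ↭ es′ → nim vs es ≡ nim vs′ es′
    nim-resp-↭-bounded (suc b) {vs} {vs′} {es} {es′} (s≤s bound) pv pe =
      trans (nim≡mex-options vs es) (trans
        (mex-cong (options-resp-↭ b vs vs′ es es′ bound pv pe (nim-resp-↭-bounded b))
                  (options-resp-↭ b vs′ vs es′ es bound′ (↭-sym pv) (↭-sym pe) (nim-resp-↭-bounded b)))
        (sym (nim≡mex-options vs′ es′)))
      where
      bound′ : size vs′ es′ ≤ b
      bound′ = subst (_≤ b) (cong₂ _+_ (↭-length pv) (↭-length pe)) bound

  nim-resp-↭ : ∀ {vs vs′ es es′} → vs ↭ vs′ → es ↭ es′ → nim vs es ≡ nim vs′ es′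
  nim-resp-↭ {vs} {vs′} {es} = nim-resp-↭-bounded (suc (size vs es)) ≤-refl

module Relabel {V W : Set} (_≟V_ : DecidableEquality V) (_≟W_ : DecidableEquality W)
               (ψ : V → W) (ψ-injective : ∀ {x y} → ψ x ≡ ψ y → x ≡ y) where
  private
    module CV = Chomp _≟V_
    module CW = Chomp _≟W_

  mapEdge : V × V → W × W
  mapEdge = Prod.map ψ ψ

  mapEdge-injective : ∀ {e e′} → mapEdge e ≡ mapEdge e′ → e ≡ e′
  mapEdge-injective {a , b} {a′ , b′} eq with ,-injective eq
  ... | ψa≡ , ψb≡ = cong₂ _,_ (ψ-injective ψa≡) (ψ-injective ψb≡)

  deleteVertex-map : ∀ v es → CW.deleteVertex (ψ v) (map mapEdge es) ≡ map mapEdge (CV.deleteVertex v es)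
  deleteVertex-map v = filter-map _ _ mapEdge (λ e →
    cong (λ b → does ((if b then false else true) Bool.≟ true)) (incident-map _≟V_ _≟W_ ψ ψ-injective v (proj₁ e) (proj₂ e)))

  nimF-map : ∀ f vs es → nimF _≟W_ f (map ψ vs) (map mapEdge es) ≡ nimF _≟V_ f vs es
  nimF-map zero vs es = refl
  nimF-map (suc f) vs es = cong mex (cong₂ _++_
    (begin
      map (λ p → nimF _≟W_ f (proj₂ p) (CW.deleteVertex (proj₁ p) (map mapEdge es))) (picks (map ψ vs))
    ≡⟨ cong (map _) (picks-map ψ vs) ⟩
      map (λ p → nimF _≟W_ f (proj₂ p) (CW.deleteVertex (proj₁ p) (map mapEdge es))) (map (Prod.map ψ (map ψ)) (picks vs))
    ≡⟨ sym (map-∘ (picks vs)) ⟩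
      map (λ p → nimF _≟W_ f (map ψ (proj₂ p)) (CW.deleteVertex (ψ (proj₁ p)) (map mapEdge es))) (picks vs)
    ≡⟨ map-cong (λ p → trans (cong (nimF _≟W_ f (map ψ (proj₂ p))) (deleteVertex-map (proj₁ p) es))
                             (nimF-map f (proj₂ p) (CV.deleteVertex (proj₁ p) es))) (picks vs) ⟩
      map (λ p → nimF _≟V_ f (proj₂ p) (CV.deleteVertex (proj₁ p) es)) (picks vs) ∎)
    (begin
      map (λ p → nimF _≟W_ f (map ψ vs) (proj₂ p)) (picks (map mapEdge es))
    ≡⟨ cong (map _) (picks-map mapEdge es) ⟩
      map (λ p → nimF _≟W_ f (map ψ vs) (proj₂ p)) (map (Prod.map mapEdge (map mapEdge)) (picks es))
    ≡⟨ sym (map-∘ (picks es)) ⟩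
      map (λ p → nimF _≟W_ f (map ψ vs) (map mapEdge (proj₂ p))) (picks es)
    ≡⟨ map-cong (λ p → nimF-map f vs (proj₂ p)) (picks es) ⟩
      map (λ p → nimF _≟V_ f vs (proj₂ p)) (picks es) ∎))
    where open ≡-Reasoning

  nim-map : ∀ vs es → CW.nim (map ψ vs) (map mapEdge es) ≡ CV.nim vs es
  nim-map vs es =
    trans (cong (λ f → nimF _≟W_ (suc f) (map ψ vs) (map mapEdge es)) (cong₂ _+_ (length-map ψ vs) (length-map mapEdge es)))
          (nimF-map (suc (CV.size vs es)) vs es)

  nim-iso : ∀ {vs es vs′ es′} → map ψ vs ↭ vs′ → map mapEdge es ↭ es′ → CW.nim vs′ es′ ≡ CV.nim vs es
  nim-iso {vs} {es} pv pe = trans (CW.nim-resp-↭ (↭-sym pv) (↭-sym pe)) (nim-map vs es)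

module Mirror {V : Set} (_≟_ : DecidableEquality V)
              (σ : V → V) (σ-involutive : ∀ v → σ (σ v) ≡ v)
              (σE : V × V → V × V)
              (σE-shape : ∀ a b → σE (a , b) ≡ (σ a , σ b) ⊎ σE (a , b) ≡ (σ b , σ a)) where
  open Chomp _≟_

  _≟E_ : DecidableEquality Edge
  _≟E_ = ≡-dec _≟_ _≟_

  σ-injective : ∀ {x y} → σ x ≡ σ y → x ≡ y
  σ-injective {x} {y} σx≡σy = trans (sym (σ-involutive x)) (trans (cong σ σx≡σy) (σ-involutive y))

  σ-moved : ∀ {v} → σ v ≢ v → σ (σ v) ≢ σ v
  σ-moved {v} σv≢v σσv≡σv = σv≢v (sym (trans (sym (σ-involutive v)) σσv≡σv))

  fixedVertices : List V → List V
  fixedVertices = filter (λ v → σ v ≟ v)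

  fixedEdges : List Edge → List Edge
  fixedEdges = filter (λ e → σE e ≟E e)

  -- The last field says that no edge joins a vertex to its mirror image.
  record Symmetric (vs : List V) (es : List Edge) : Set where
    field
      permutes-vertices : Permutes σ vs
      permutes-edges    : Permutes σE es
      σE-involutive     : ∀ {e} → e ∈ es → σE (σE e) ≡ e
      fixed-edge-ends   : ∀ {e} → e ∈ es → σE e ≡ e → σ (proj₁ e) ≡ proj₁ e × σ (proj₂ e) ≡ proj₂ e
  open Symmetric

  incident-σ : ∀ v e → incident _≟_ (σ v) (σE e) ≡ incident _≟_ v e
  incident-σ v (a , b) with σE (a , b) | σE-shape a b
  ... | _ | inj₁ refl = incident-map _≟_ _≟_ σ σ-injective v a b
  ... | _ | inj₂ refl = trans (incident-map _≟_ _≟_ σ σ-injective v b a) (incident-swap _≟_ v a b)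

  deleteVertex-σ : ∀ v es → deleteVertex (σ v) (map σE es) ≡ map σE (deleteVertex v es)
  deleteVertex-σ v = filter-map _ _ σE (λ e →
    cong (λ b → does ((if b then false else true) Bool.≟ true)) (incident-σ v e))

  deleteVertex-⊆ : ∀ {v e} es → e ∈ deleteVertex v es → e ∈ es
  deleteVertex-⊆ es e∈ = proj₁ (∈-filter⁻ _ e∈)

  deleteVertex-fixedEdges : ∀ {v vs es} → Symmetric vs es → σ v ≢ v → deleteVertex v (fixedEdges es) ≡ fixedEdges es
  deleteVertex-fixedEdges {v} {es = es} S σv≢v = filter-all _ (All.tabulate kept)
    where
    kept : ∀ {e} → e ∈ fixedEdges es → notIncident _≟_ v e ≡ true
    kept {a , b} e∈ with ∈-filter⁻ _ e∈
    ... | e∈es , fixed with fixed-edge-ends S e∈es fixed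
    ... | σa≡a , σb≡b = cong (λ z → if z then false else true)
      (incident-≢ _≟_ (λ { refl → σv≢v σa≡a }) (λ { refl → σv≢v σb≡b }))

  Symmetric-deleteFixedVertex : ∀ {v r vs es} → Symmetric vs es → (v , r) ∈ picks vs → σ v ≡ v →
    Symmetric r (deleteVertex v es)
  Symmetric-deleteFixedVertex {v} {r} {vs} {es} S p σv≡v = record
    { permutes-vertices = Permutes-remove-fixed (permutes-vertices S) (picks⇒↭ vs p) σv≡v
    ; permutes-edges    = ↭-trans (filter-↭ _ (permutes-edges S)) (↭-reflexive (begin
        deleteVertex v (map σE es)     ≡⟨ cong (λ x → deleteVertex x (map σE es)) σv≡v ⟨
        deleteVertex (σ v) (map σE es) ≡⟨ deleteVertex-σ v es ⟩
        map σE (deleteVertex v es)     ∎))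
    ; σE-involutive     = λ e∈ → σE-involutive S (deleteVertex-⊆ es e∈)
    ; fixed-edge-ends   = λ e∈ → fixed-edge-ends S (deleteVertex-⊆ es e∈) }
    where open ≡-Reasoning

  Symmetric-deleteFixedEdge : ∀ {e r vs es} → Symmetric vs es → (e , r) ∈ picks es → σE e ≡ e → Symmetric vs r
  Symmetric-deleteFixedEdge {es = es} S p σEe≡e = record
    { permutes-vertices = permutes-vertices S
    ; permutes-edges    = Permutes-remove-fixed (permutes-edges S) (picks⇒↭ es p) σEe≡e
    ; σE-involutive     = λ e∈ → σE-involutive S (↭∷⇒tail⊆ (picks⇒↭ es p) e∈)
    ; fixed-edge-ends   = λ e∈ → fixed-edge-ends S (↭∷⇒tail⊆ (picks⇒↭ es p) e∈) }

  Symmetric-deleteVertexPair : ∀ {v r r′ vs es} → Symmetric vs es → (v , r) ∈ picks vs → (σ v , r′) ∈ picks r →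
    Symmetric r′ (deleteVertex (σ v) (deleteVertex v es))
  Symmetric-deleteVertexPair {v} {r} {r′} {vs} {es} S p p′ = record
    { permutes-vertices = Permutes-remove-swap (permutes-vertices S) (picks⇒↭ vs p) (picks⇒↭ r p′) refl (σ-involutive v)
    ; permutes-edges    = ↭-trans (filter-↭ _ (filter-↭ _ (permutes-edges S))) (↭-reflexive (begin
        deleteVertex (σ v) (deleteVertex v (map σE es))
          ≡⟨ cong (λ x → deleteVertex (σ v) (deleteVertex x (map σE es))) (σ-involutive v) ⟨
        deleteVertex (σ v) (deleteVertex (σ (σ v)) (map σE es))
          ≡⟨ cong (deleteVertex (σ v)) (deleteVertex-σ (σ v) es) ⟩
        deleteVertex (σ v) (map σE (deleteVertex (σ v) es))
          ≡⟨ deleteVertex-σ v (deleteVertex (σ v) es) ⟩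
        map σE (deleteVertex v (deleteVertex (σ v) es))
          ≡⟨ cong (map σE) (filter-comm _ _ es) ⟩
        map σE (deleteVertex (σ v) (deleteVertex v es)) ∎))
    ; σE-involutive     = λ e∈ → σE-involutive S (inner e∈)
    ; fixed-edge-ends   = λ e∈ → fixed-edge-ends S (inner e∈) }
    where
    open ≡-Reasoning
    inner : ∀ {e} → e ∈ deleteVertex (σ v) (deleteVertex v es) → e ∈ es
    inner e∈ = deleteVertex-⊆ es (deleteVertex-⊆ (deleteVertex v es) e∈)

  Symmetric-deleteEdgePair : ∀ {e r r′ vs es} → Symmetric vs es → (e , r) ∈ picks es → (σE e , r′) ∈ picks r →
    Symmetric vs r′
  Symmetric-deleteEdgePair {e} {r} {r′} {vs} {es} S p p′ = record
    { permutes-vertices = permutes-vertices S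
    ; permutes-edges    = Permutes-remove-swap (permutes-edges S) (picks⇒↭ es p) (picks⇒↭ r p′) refl
                            (σE-involutive S (↭∷⇒head∈ (picks⇒↭ es p)))
    ; σE-involutive     = λ x∈ → σE-involutive S (inner x∈)
    ; fixed-edge-ends   = λ x∈ → fixed-edge-ends S (inner x∈) }
    where
    inner : r′ ⊆ es
    inner x∈ = ↭∷⇒tail⊆ (picks⇒↭ es p) (↭∷⇒tail⊆ (picks⇒↭ r p′) x∈)

  fixedVertices-remove : ∀ {v r r*} vs → (v , r) ∈ picks vs → (v , r*) ∈ picks (fixedVertices vs) → σ v ≡ v →
    fixedVertices r ↭ r*
  fixedVertices-remove vs p p* σv≡v = drop-∷ (↭-trans
    (↭-sym (subst (fixedVertices vs ↭_) (filter-accept (λ v → σ v ≟ v) σv≡v) (filter-↭ _ (picks⇒↭ vs p))))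
    (picks⇒↭ (fixedVertices vs) p*))

  fixedEdges-remove : ∀ {e r r*} es → (e , r) ∈ picks es → (e , r*) ∈ picks (fixedEdges es) → σE e ≡ e →
    fixedEdges r ↭ r*
  fixedEdges-remove es p p* σEe≡e = drop-∷ (↭-trans
    (↭-sym (subst (fixedEdges es ↭_) (filter-accept (λ e → σE e ≟E e) σEe≡e) (filter-↭ _ (picks⇒↭ es p))))
    (picks⇒↭ (fixedEdges es) p*))

  MirrorBelow : ℕ → Set
  MirrorBelow b = ∀ vs es → size vs es < b → Symmetric vs es → nim vs es ≡ nim (fixedVertices vs) (fixedEdges es)

  module MirrorStep {vs es} (S : Symmetric vs es) (ih : MirrorBelow (size vs es)) where

    nim* : ℕ
    nim* = nim (fixedVertices vs) (fixedEdges es)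

    fixedVertexMove : ∀ {v r r*} → (v , r) ∈ picks vs → (v , r*) ∈ picks (fixedVertices vs) → σ v ≡ v →
      nim r (deleteVertex v es) ≡ nim r* (deleteVertex v (fixedEdges es))
    fixedVertexMove {v} {r} {r*} p p* σv≡v = trans
      (ih _ _ (size-vertexMove< vs es p) (Symmetric-deleteFixedVertex S p σv≡v))
      (nim-resp-↭ (fixedVertices-remove vs p p* σv≡v) (↭-reflexive (filter-comm _ _ es)))

    fixedEdgeMove : ∀ {e r r*} → (e , r) ∈ picks es → (e , r*) ∈ picks (fixedEdges es) → σE e ≡ e →
      nim vs r ≡ nim (fixedVertices vs) r*
    fixedEdgeMove p p* σEe≡e = trans
      (ih _ _ (size-edgeMove< vs es p) (Symmetric-deleteFixedEdge S p σEe≡e))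
      (nim-resp-↭ {fixedVertices vs} ↭-refl (fixedEdges-remove es p p* σEe≡e))

    pairedVertexMove : ∀ {v r r′} → (v , r) ∈ picks vs → (σ v , r′) ∈ picks r → σ v ≢ v →
      nim r′ (deleteVertex (σ v) (deleteVertex v es)) ≡ nim*
    pairedVertexMove {v} {r} {r′} p p′ σv≢v = trans
      (ih r′ _ (<-trans (size-vertexMove< r (deleteVertex v es) p′) (size-vertexMove< vs es p))
              (Symmetric-deleteVertexPair S p p′))
      (nim-resp-↭ same-vertices (↭-reflexive same-edges))
      where
      open ≡-Reasoning
      same-vertices : fixedVertices r′ ↭ fixedVertices vs
      same-vertices = ↭-sym (subst (fixedVertices vs ↭_)
        (trans (filter-reject (λ v → σ v ≟ v) σv≢v) (filter-reject (λ v → σ v ≟ v) (σ-moved σv≢v)))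
        (filter-↭ _ (↭-trans (picks⇒↭ vs p) (↭-prep v (picks⇒↭ r p′)))))
      same-edges : fixedEdges (deleteVertex (σ v) (deleteVertex v es)) ≡ fixedEdges es
      same-edges = begin
          fixedEdges (deleteVertex (σ v) (deleteVertex v es))
        ≡⟨ filter-comm _ _ (deleteVertex v es) ⟩
          deleteVertex (σ v) (fixedEdges (deleteVertex v es))
        ≡⟨ cong (deleteVertex (σ v)) (filter-comm _ _ es) ⟩
          deleteVertex (σ v) (deleteVertex v (fixedEdges es))
        ≡⟨ cong (deleteVertex (σ v)) (deleteVertex-fixedEdges S σv≢v) ⟩
          deleteVertex (σ v) (fixedEdges es)
        ≡⟨ deleteVertex-fixedEdges S (σ-moved σv≢v) ⟩
          fixedEdges es ∎

    pairedEdgeMove : ∀ {e r r′} → (e , r) ∈ picks es → (σE e , r′) ∈ picks r → σE e ≢ e → nim vs r′ ≡ nim*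
    pairedEdgeMove {e} {r} {r′} p p′ σEe≢e = trans
      (ih vs r′ (<-trans (size-edgeMove< vs r p′) (size-edgeMove< vs es p)) (Symmetric-deleteEdgePair S p p′))
      (nim-resp-↭ {fixedVertices vs} ↭-refl same-edges)
      where
      σE-moved : σE (σE e) ≢ σE e
      σE-moved eq = σEe≢e (sym (trans (sym (σE-involutive S (↭∷⇒head∈ (picks⇒↭ es p)))) eq))
      same-edges : fixedEdges r′ ↭ fixedEdges es
      same-edges = ↭-sym (subst (fixedEdges es ↭_)
        (trans (filter-reject (λ e → σE e ≟E e) σEe≢e) (filter-reject (λ e → σE e ≟E e) σE-moved))
        (filter-↭ _ (↭-trans (picks⇒↭ es p) (↭-prep e (picks⇒↭ r p′)))))

    below-nim*⊆options : ∀ u → u < nim* → u ∈ options vs es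
    below-nim*⊆options u u<nim* with options⁻ (fixedVertices vs) (fixedEdges es) (<nim⇒∈options (fixedVertices vs) (fixedEdges es) u u<nim*)
    ... | vertexMove p* refl =
      let (v∈vs , σv≡v) = ∈-filter⁻ _ (↭∷⇒head∈ (picks⇒↭ (fixedVertices vs) p*))
          (r , p) = ∈⇒picks vs v∈vs
      in subst (_∈ options vs es) (fixedVertexMove p p* σv≡v) (vertexMove∈options vs es p)
    ... | edgeMove p* refl =
      let (e∈es , σEe≡e) = ∈-filter⁻ _ (↭∷⇒head∈ (picks⇒↭ (fixedEdges es) p*))
          (r , p) = ∈⇒picks es e∈es
      in subst (_∈ options vs es) (fixedEdgeMove p p* σEe≡e) (edgeMove∈options vs es p)

    nim*∉options : nim* ∉ options vs es
    nim*∉options nim*∈ with options⁻ vs es nim*∈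
    ... | vertexMove {v} {r} p nim*≡ with σ v ≟ v
    ...   | yes σv≡v =
      let (r* , p*) = ∈⇒picks (fixedVertices vs) (∈-filter⁺ _ (↭∷⇒head∈ (picks⇒↭ vs p)) σv≡v)
      in vertexMove≢nim (fixedVertices vs) (fixedEdges es) p* (trans (sym (fixedVertexMove p p* σv≡v)) (sym nim*≡))
    ...   | no σv≢v =
      let σv∈r = ↭∷⇒∈tail (picks⇒↭ vs p) (Permutes⇒∈ (permutes-vertices S) (↭∷⇒head∈ (picks⇒↭ vs p))) σv≢v
          (r′ , p′) = ∈⇒picks r σv∈r
      in vertexMove≢nim r (deleteVertex v es) p′ (trans (pairedVertexMove p p′ σv≢v) nim*≡)
    nim*∉options nim*∈ | edgeMove {e} {r} p nim*≡ with σE e ≟E e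
    ...   | yes σEe≡e =
      let (r* , p*) = ∈⇒picks (fixedEdges es) (∈-filter⁺ _ (↭∷⇒head∈ (picks⇒↭ es p)) σEe≡e)
      in edgeMove≢nim (fixedVertices vs) (fixedEdges es) p* (trans (sym (fixedEdgeMove p p* σEe≡e)) (sym nim*≡))
    ...   | no σEe≢e =
      let σEe∈r = ↭∷⇒∈tail (picks⇒↭ es p) (Permutes⇒∈ (permutes-edges S) (↭∷⇒head∈ (picks⇒↭ es p))) σEe≢e
          (r′ , p′) = ∈⇒picks r σEe∈r
      in edgeMove≢nim vs r p′ (trans (pairedEdgeMove p p′ σEe≢e) nim*≡)

  private
    nim-mirror-below : ∀ b → MirrorBelow b
    nim-mirror-below (suc b) vs es (s≤s size≤b) S = nim-unique vs es _ nim*∉options below-nim*⊆options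
      where
      open MirrorStep S (λ vs′ es′ size< → nim-mirror-below b vs′ es′ (≤-trans size< size≤b))

  nim-mirror : ∀ {vs es} → Symmetric vs es → nim vs es ≡ nim (fixedVertices vs) (fixedEdges es)
  nim-mirror {vs} {es} = nim-mirror-below (suc (size vs es)) vs es ≤-refl

unique-↭ : {A : Set} {xs ys : List A} → Unique xs → Unique ys → (∀ {x} → x ∈ xs → x ∈ ys) → (∀ {x} → x ∈ ys → x ∈ xs) → xs ↭ ys
unique-↭ ux uy xs⊆ys ys⊆xs = ∼bag⇒↭ (unique∧set⇒bag ux uy (mk⇔ xs⊆ys ys⊆xs))

isStrictTotalOrder-≡ : {A : Set} {_≈_ _<_ : Rel A 0ℓ} → (∀ {x y} → x ≈ y → x ≡ y) →
  IsStrictTotalOrder _≈_ _<_ → IsStrictTotalOrder _≡_ _<_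
isStrictTotalOrder-≡ {_<_ = _<_} ≈⇒≡ O = record
  { isStrictPartialOrder = record
    { isEquivalence = isEquivalence
    ; irrefl        = λ { refl → O.irrefl O.Eq.refl }
    ; trans         = O.trans
    ; <-resp-≈      = resp₂ _<_ }
  ; compare = compare≡ }
  where
  module O = IsStrictTotalOrder O
  compare≡ : Trichotomous _≡_ _<_
  compare≡ x y with O.compare x y
  ... | tri< x<y x≉y x≯y = tri< x<y (λ { refl → x≉y O.Eq.refl }) x≯y
  ... | tri≈ x≮y x≈y x≯y = tri≈ x≮y (≈⇒≡ x≈y) x≯y
  ... | tri> x≮y x≉y x>y = tri> x≮y (λ { refl → x≉y O.Eq.refl }) x>y

×-Lex-isStrictTotalOrder : {A B : Set} {_<₁_ : Rel A 0ℓ} {_<₂_ : Rel B 0ℓ} →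
  IsStrictTotalOrder _≡_ _<₁_ → IsStrictTotalOrder _≡_ _<₂_ → IsStrictTotalOrder _≡_ (×-Lex _≡_ _<₁_ _<₂_)
×-Lex-isStrictTotalOrder O₁ O₂ = isStrictTotalOrder-≡ ≡×≡⇒≡ (×-isStrictTotalOrder O₁ O₂)

module _ {A : Set} {_<_ : Rel A 0ℓ} (O : IsStrictTotalOrder _≡_ _<_) where
  open IsStrictTotalOrder O using (irrefl; asym)

  sorted⇒unique : ∀ {xs} → AllPairs _<_ xs → Unique xs
  sorted⇒unique = AllPairs.map (λ x<y x≡y → irrefl x≡y x<y)

  pairs⁻ : ∀ {xs a b} → AllPairs _<_ xs → (a , b) ∈ pairs xs → a ∈ xs × b ∈ xs × a < b
  pairs⁻ {x ∷ xs} (x<xs ∷ sorted) ab∈ with ∈-++⁻ (map (x ,_) xs) ab∈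
  ... | inj₁ q with ∈-map⁻ (x ,_) q
  ...   | b , b∈xs , refl = here refl , there b∈xs , All.lookup x<xs b∈xs
  pairs⁻ {x ∷ xs} (x<xs ∷ sorted) ab∈ | inj₂ q with pairs⁻ sorted q
  ...   | a∈xs , b∈xs , a<b = there a∈xs , there b∈xs , a<b

  pairs⁺ : ∀ {xs a b} → AllPairs _<_ xs → a ∈ xs → b ∈ xs → a < b → (a , b) ∈ pairs xs
  pairs⁺ {x ∷ xs} (x<xs ∷ sorted) (here refl) (here refl) a<b = ⊥-elim (irrefl refl a<b)
  pairs⁺ {x ∷ xs} (x<xs ∷ sorted) (here refl) (there b∈xs) a<b = ∈-++⁺ˡ (∈-map⁺ (x ,_) b∈xs)
  pairs⁺ {x ∷ xs} (x<xs ∷ sorted) (there a∈xs) (here refl) a<b = ⊥-elim (asym a<b (All.lookup x<xs a∈xs))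
  pairs⁺ {x ∷ xs} (x<xs ∷ sorted) (there a∈xs) (there b∈xs) a<b = ∈-++⁺ʳ (map (x ,_) xs) (pairs⁺ sorted a∈xs b∈xs a<b)

module _ {A B : Set} {_<₁_ : Rel A 0ℓ} {_<₂_ : Rel B 0ℓ}
         (O₁ : IsStrictTotalOrder _≡_ _<₁_) (O₂ : IsStrictTotalOrder _≡_ _<₂_) where

  monotone-reflects : (f : A → B) → (∀ {x y} → x <₁ y → f x <₂ f y) → ∀ {x y} → f x <₂ f y → x <₁ y
  monotone-reflects f mono {x} {y} fx<fy with IsStrictTotalOrder.compare O₁ x y
  ... | tri< x<y _ _ = x<y
  ... | tri≈ _ refl _ = ⊥-elim (IsStrictTotalOrder.irrefl O₂ refl fx<fy)
  ... | tri> _ _ y<x = ⊥-elim (IsStrictTotalOrder.asym O₂ fx<fy (mono y<x))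

  cartesianProduct-sorted : ∀ {xs ys} → AllPairs _<₁_ xs → AllPairs _<₂_ ys →
    AllPairs (×-Lex _≡_ _<₁_ _<₂_) (cartesianProduct xs ys)
  cartesianProduct-sorted {[]} [] sorted₂ = []
  cartesianProduct-sorted {x ∷ xs} {ys} (x<xs ∷ sorted₁) sorted₂ =
    AllPairs.++⁺ (AllPairs.map⁺ (AllPairs.map (λ y<y′ → inj₂ (refl , y<y′)) sorted₂))
                 (cartesianProduct-sorted sorted₁ sorted₂)
                 (All.tabulate λ p∈ → All.tabulate λ q∈ → first-smaller p∈ q∈)
    where
    first-smaller : ∀ {p q} → p ∈ map (x ,_) ys → q ∈ cartesianProduct xs ys → ×-Lex _≡_ _<₁_ _<₂_ p q
    first-smaller p∈ q∈ with ∈-map⁻ (x ,_) p∈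
    ... | _ , _ , refl = inj₁ (All.lookup x<xs (proj₁ (∈-cartesianProduct⁻ xs ys q∈)))

pairs-fst : {A : Set} {xs : List A} {a b : A} → (a , b) ∈ pairs xs → a ∈ xs
pairs-fst {xs = x ∷ xs} ab∈ with ∈-++⁻ (map (x ,_) xs) ab∈
... | inj₁ q with ∈-map⁻ (x ,_) q
...   | _ , _ , refl = here refl
pairs-fst {xs = x ∷ xs} ab∈ | inj₂ q = there (pairs-fst q)

pairs-unique : {A : Set} {xs : List A} → Unique xs → Unique (pairs xs)
pairs-unique [] = []
pairs-unique {xs = x ∷ xs} (x∉xs ∷ unique) =
  Unique.++⁺ (Unique.map⁺ (proj₂ ∘ ,-injective) unique) (pairs-unique unique) disjoint
  where
  disjoint : ∀ {p} → ¬ (p ∈ map (x ,_) xs × p ∈ pairs xs)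
  disjoint (p∈ , p∈pairs) with ∈-map⁻ (x ,_) p∈
  ... | b , b∈xs , refl = All.lookup x∉xs (pairs-fst p∈pairs) refl

pairsWith≡cartesianProduct : {A B : Set} (xs : List A) (ys : List B) → pairsWith xs ys ≡ cartesianProduct xs ys
pairsWith≡cartesianProduct [] ys = refl
pairsWith≡cartesianProduct (x ∷ xs) ys = cong (map (x ,_) ys ++_) (pairsWith≡cartesianProduct xs ys)

-- allSubsets is sorted lexicographically, so every edge list built with pairs is increasing.
_≺_ : ∀ {n} → Vec Bool n → Vec Bool n → Set
[] ≺ [] = ⊥
(false ∷ x) ≺ (false ∷ y) = x ≺ y
(false ∷ x) ≺ (true ∷ y) = ⊤
(true ∷ x) ≺ (false ∷ y) = ⊥
(true ∷ x) ≺ (true ∷ y) = x ≺ y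

≺-irrefl : ∀ {n} {x y : Vec Bool n} → x ≡ y → ¬ x ≺ y
≺-irrefl {x = []} refl ()
≺-irrefl {x = false ∷ x} refl = ≺-irrefl {x = x} refl
≺-irrefl {x = true ∷ x} refl = ≺-irrefl {x = x} refl

≺-trans : ∀ {n} {x y z : Vec Bool n} → x ≺ y → y ≺ z → x ≺ z
≺-trans {x = []} {[]} {[]} () q
≺-trans {x = false ∷ x} {false ∷ y} {false ∷ z} p q = ≺-trans {x = x} {y} {z} p q
≺-trans {x = false ∷ x} {false ∷ y} {true ∷ z} p q = tt
≺-trans {x = false ∷ x} {true ∷ y} {true ∷ z} p q = tt
≺-trans {x = true ∷ x} {true ∷ y} {true ∷ z} p q = ≺-trans {x = x} {y} {z} p q

≺-compare : ∀ {n} → Trichotomous _≡_ (_≺_ {n})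
≺-compare [] [] = tri≈ (λ ()) refl (λ ())
≺-compare (false ∷ x) (true ∷ y) = tri< tt (λ ()) (λ ())
≺-compare (true ∷ x) (false ∷ y) = tri> (λ ()) (λ ()) tt
≺-compare (false ∷ x) (false ∷ y) with ≺-compare x y
... | tri< x≺y x≢y y⊀x = tri< x≺y (x≢y ∘ Vec.∷-injectiveʳ) y⊀x
... | tri≈ x⊀y refl y⊀x = tri≈ x⊀y refl y⊀x
... | tri> x⊀y x≢y y≺x = tri> x⊀y (x≢y ∘ Vec.∷-injectiveʳ) y≺x
≺-compare (true ∷ x) (true ∷ y) with ≺-compare x y
... | tri< x≺y x≢y y⊀x = tri< x≺y (x≢y ∘ Vec.∷-injectiveʳ) y⊀x
... | tri≈ x⊀y refl y⊀x = tri≈ x⊀y refl y⊀x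
... | tri> x⊀y x≢y y≺x = tri> x⊀y (x≢y ∘ Vec.∷-injectiveʳ) y≺x

≺-isStrictTotalOrder : ∀ {n} → IsStrictTotalOrder _≡_ (_≺_ {n})
≺-isStrictTotalOrder = record
  { isStrictPartialOrder = record
    { isEquivalence = isEquivalence
    ; irrefl        = ≺-irrefl
    ; trans         = λ {x} {y} {z} → ≺-trans {x = x} {y} {z}
    ; <-resp-≈      = resp₂ _≺_ }
  ; compare = ≺-compare }

≺-++ˡ : ∀ {m n} {x x′ : Vec Bool m} {y y′ : Vec Bool n} → x ≺ x′ → (x ++ᵛ y) ≺ (x′ ++ᵛ y′)
≺-++ˡ {x = []} {[]} ()
≺-++ˡ {x = false ∷ x} {false ∷ x′} p = ≺-++ˡ {x = x} {x′} p
≺-++ˡ {x = false ∷ x} {true ∷ x′} p = tt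
≺-++ˡ {x = true ∷ x} {true ∷ x′} p = ≺-++ˡ {x = x} {x′} p

≺-++ʳ : ∀ {m n} (x : Vec Bool m) {y y′ : Vec Bool n} → y ≺ y′ → (x ++ᵛ y) ≺ (x ++ᵛ y′)
≺-++ʳ [] p = p
≺-++ʳ (false ∷ x) p = ≺-++ʳ x p
≺-++ʳ (true ∷ x) p = ≺-++ʳ x p

allSubsets-sorted : ∀ n → AllPairs _≺_ (allSubsets n)
allSubsets-sorted zero = All.[] ∷ []
allSubsets-sorted (suc n) =
  AllPairs.++⁺ (AllPairs.map⁺ (allSubsets-sorted n)) (AllPairs.map⁺ (allSubsets-sorted n))
    (All.tabulate λ p∈ → All.tabulate λ q∈ → false-first p∈ q∈)
  where
  false-first : ∀ {p q} → p ∈ map (false ∷_) (allSubsets n) → q ∈ map (true ∷_) (allSubsets n) → p ≺ q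
  false-first p∈ q∈ with ∈-map⁻ (false ∷_) p∈ | ∈-map⁻ (true ∷_) q∈
  ... | _ , _ , refl | _ , _ , refl = tt

∈-allSubsets : ∀ {n} (s : Subset n) → s ∈ allSubsets n
∈-allSubsets [] = here refl
∈-allSubsets {suc n} (false ∷ s) = ∈-++⁺ˡ (∈-map⁺ (false ∷_) (∈-allSubsets s))
∈-allSubsets {suc n} (true ∷ s) = ∈-++⁺ʳ (map (false ∷_) (allSubsets n)) (∈-map⁺ (true ∷_) (∈-allSubsets s))

∣p++q∣≡∣p∣+∣q∣ : ∀ {m n} (p : Subset m) (q : Subset n) → ∣ p ++ᵛ q ∣ ≡ ∣ p ∣ + ∣ q ∣
∣p++q∣≡∣p∣+∣q∣ [] q = refl
∣p++q∣≡∣p∣+∣q∣ (false ∷ p) q = ∣p++q∣≡∣p∣+∣q∣ p q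
∣p++q∣≡∣p∣+∣q∣ (true ∷ p) q = cong suc (∣p++q∣≡∣p∣+∣q∣ p q)

∣p++q∣≡∣q++p∣ : ∀ {m n} (p : Subset m) (q : Subset n) → ∣ p ++ᵛ q ∣ ≡ ∣ q ++ᵛ p ∣
∣p++q∣≡∣q++p∣ p q =
  trans (∣p++q∣≡∣p∣+∣q∣ p q) (trans (+-comm ∣ p ∣ ∣ q ∣) (sym (∣p++q∣≡∣p∣+∣q∣ q p)))

∩-++ : ∀ {m n} (p p′ : Subset m) (q q′ : Subset n) → (p ++ᵛ q) ∩ (p′ ++ᵛ q′) ≡ (p ∩ p′) ++ᵛ (q ∩ q′)
∩-++ p p′ q q′ = Vec.zipWith-++ _∧_ p q p′ q′

∣p∣+∣q∣≤∣p∩q∣+∣q∩p∣+n : ∀ {n} (p q : Subset n) → ∣ p ∣ + ∣ q ∣ ≤ (∣ p ∩ q ∣ + ∣ q ∩ p ∣) + n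
∣p∣+∣q∣≤∣p∩q∣+∣q∩p∣+n [] [] = z≤n
∣p∣+∣q∣≤∣p∩q∣+∣q∩p∣+n {suc n} (false ∷ p) (false ∷ q) =
  ≤-trans (∣p∣+∣q∣≤∣p∩q∣+∣q∩p∣+n p q) (+-monoʳ-≤ (∣ p ∩ q ∣ + ∣ q ∩ p ∣) (n≤1+n n))
∣p∣+∣q∣≤∣p∩q∣+∣q∩p∣+n {suc n} (false ∷ p) (true ∷ q) rewrite +-suc ∣ p ∣ ∣ q ∣ | +-suc (∣ p ∩ q ∣ + ∣ q ∩ p ∣) n =
  s≤s (∣p∣+∣q∣≤∣p∩q∣+∣q∩p∣+n p q)
∣p∣+∣q∣≤∣p∩q∣+∣q∩p∣+n {suc n} (true ∷ p) (false ∷ q) rewrite +-suc (∣ p ∩ q ∣ + ∣ q ∩ p ∣) n =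
  s≤s (∣p∣+∣q∣≤∣p∩q∣+∣q∩p∣+n p q)
∣p∣+∣q∣≤∣p∩q∣+∣q∩p∣+n {suc n} (true ∷ p) (true ∷ q) rewrite +-suc ∣ p ∣ ∣ q ∣ | +-suc ∣ p ∩ q ∣ ∣ q ∩ p ∣ =
  s≤s (s≤s (≤-trans (∣p∣+∣q∣≤∣p∩q∣+∣q∩p∣+n p q) (+-monoʳ-≤ (∣ p ∩ q ∣ + ∣ q ∩ p ∣) (n≤1+n n))))

map-↭ : {A B : Set} {f : A → B} {xs : List A} {ys : List B} → (∀ {x y} → f x ≡ f y → x ≡ y) →
  Unique xs → Unique ys → (∀ {x} → x ∈ xs → f x ∈ ys) → (∀ {y} → y ∈ ys → Σ[ x ∈ A ] x ∈ xs × y ≡ f x) →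
  map f xs ↭ ys
map-↭ {f = f} {xs} f-injective xs-unique ys-unique into onto =
  unique-↭ (Unique.map⁺ f-injective xs-unique) ys-unique image⊆ ⊆image
  where
  image⊆ : ∀ {y} → y ∈ map f xs → y ∈ _
  image⊆ y∈ with ∈-map⁻ f y∈
  ... | x , x∈ , refl = into x∈
  ⊆image : ∀ {y} → y ∈ _ → y ∈ map f xs
  ⊆image y∈ with onto y∈
  ... | x , x∈ , refl = ∈-map⁺ f x∈

map-disjoint : {A B C : Set} {f : A → C} {g : B → C} → (∀ {x y} → f x ≢ g y) →
  ∀ {xs ys v} → ¬ (v ∈ map f xs × v ∈ map g ys)
map-disjoint {f = f} {g} f≢g (v∈f , v∈g) with ∈-map⁻ f v∈f | ∈-map⁻ g v∈g
... | _ , _ , refl | _ , _ , fx≡gy = f≢g fx≡gy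

map-unique-local : {A B : Set} (f : A → B) {xs : List A} → (∀ {x y} → x ∈ xs → y ∈ xs → f x ≡ f y → x ≡ y) →
  Unique xs → Unique (map f xs)
map-unique-local f injective-on [] = []
map-unique-local f injective-on (x∉xs ∷ unique) =
  All.tabulate (λ fy∈ fx≡fy → let (y , y∈xs , eq) = ∈-map⁻ f fy∈ in
                  All.lookup x∉xs y∈xs (injective-on (here refl) (there y∈xs) (trans fx≡fy eq)))
  ∷ map-unique-local f (λ x∈ y∈ → injective-on (there x∈) (there y∈)) unique

<∸⇒+< : ∀ {a k l} → a < k ∸ l → a + l < k
<∸⇒+< {a} {k} {l} a<k∸l = m≤o∸n⇒m+n≤o (suc a) (<⇒≤ (m∸n≢0⇒n<m k∸l≢0)) a<k∸l
  where
  k∸l≢0 : k ∸ l ≢ 0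
  k∸l≢0 k∸l≡0 = n≮0 (subst (a <_) k∸l≡0 a<k∸l)

-- Kneser-type graphs on a ground set of r elements of weight w (indexed by c) and n elements of
-- weight 1 (indexed by S): vertices have weight k, edges join vertices of common weight ≤ l.
module Weighted (n k l : ℕ) where

  Point : ℕ → Set
  Point r = Subset r × Subset n

  _≟ᴾ_ : ∀ {r} → DecidableEquality (Point r)
  _≟ᴾ_ = ≡-dec (Vec.≡-dec Bool._≟_) (Vec.≡-dec Bool._≟_)

  _<ᴾ_ : ∀ {r} → Point r → Point r → Set
  _<ᴾ_ = ×-Lex _≡_ _≺_ _≺_

  <ᴾ-isStrictTotalOrder : ∀ {r} → IsStrictTotalOrder _≡_ (_<ᴾ_ {r})
  <ᴾ-isStrictTotalOrder = ×-Lex-isStrictTotalOrder ≺-isStrictTotalOrder ≺-isStrictTotalOrder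

  weight : ∀ {r} → ℕ → Point r → ℕ
  weight w (c , S) = w * ∣ c ∣ + ∣ S ∣

  commonWeight : ∀ {r} → ℕ → Point r × Point r → ℕ
  commonWeight w ((c , S) , (d , T)) = w * ∣ c ∩ d ∣ + ∣ S ∩ T ∣

  vertexList : ℕ → ∀ r → List (Point r)
  vertexList w r = filter (λ v → weight w v ≟ k) (cartesianProduct (allSubsets r) (allSubsets n))

  edgeList : ℕ → ∀ r → List (Point r × Point r)
  edgeList w r = filter (λ e → commonWeight w e ≤? l) (pairs (vertexList w r))

  nimᵂ : ℕ → ℕ → ℕ
  nimᵂ w r = Chomp.nim _≟ᴾ_ (vertexList w r) (edgeList w r)

  vertexList-sorted : ∀ w r → AllPairs _<ᴾ_ (vertexList w r)
  vertexList-sorted w r = AllPairs.filter⁺ _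
    (cartesianProduct-sorted ≺-isStrictTotalOrder ≺-isStrictTotalOrder (allSubsets-sorted r) (allSubsets-sorted n))

  vertexList-unique : ∀ w r → Unique (vertexList w r)
  vertexList-unique w r = sorted⇒unique <ᴾ-isStrictTotalOrder (vertexList-sorted w r)

  edgeList-unique : ∀ w r → Unique (edgeList w r)
  edgeList-unique w r = Unique.filter⁺ _ (pairs-unique (vertexList-unique w r))

  ∈-vertexList⁺ : ∀ w {r} (v : Point r) → weight w v ≡ k → v ∈ vertexList w r
  ∈-vertexList⁺ w (c , S) weight≡k = ∈-filter⁺ _ (∈-cartesianProduct⁺ (∈-allSubsets c) (∈-allSubsets S)) weight≡k

  ∈-vertexList⁻ : ∀ w {r} {v : Point r} → v ∈ vertexList w r → weight w v ≡ k
  ∈-vertexList⁻ w {r} v∈ = proj₂ (∈-filter⁻ (λ v → weight w v ≟ k) {xs = cartesianProduct (allSubsets r) (allSubsets n)} v∈)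

  ∈-edgeList⁺ : ∀ w {r} {a b : Point r} → a ∈ vertexList w r → b ∈ vertexList w r → a <ᴾ b →
    commonWeight w (a , b) ≤ l → (a , b) ∈ edgeList w r
  ∈-edgeList⁺ w {r} a∈ b∈ a<b common≤l =
    ∈-filter⁺ _ (pairs⁺ <ᴾ-isStrictTotalOrder (vertexList-sorted w r) a∈ b∈ a<b) common≤l

  ∈-edgeList⁻ : ∀ w {r} {a b : Point r} → (a , b) ∈ edgeList w r →
    a ∈ vertexList w r × b ∈ vertexList w r × a <ᴾ b × commonWeight w (a , b) ≤ l
  ∈-edgeList⁻ w {r} e∈ with ∈-filter⁻ (λ e → commonWeight w e ≤? l) {xs = pairs (vertexList w r)} e∈
  ... | e∈pairs , common≤l with pairs⁻ <ᴾ-isStrictTotalOrder (vertexList-sorted w r) e∈pairs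
  ...   | a∈ , b∈ , a<b = a∈ , b∈ , a<b , common≤l

  commonWeight-comm : ∀ {r} w (a b : Point r) → commonWeight w (b , a) ≡ commonWeight w (a , b)
  commonWeight-comm w (c , S) (d , T) = cong₂ (λ x y → w * ∣ x ∣ + ∣ y ∣) (∩-comm d c) (∩-comm T S)

  module Halving (w r : ℕ) (w*r+l<k : w * r + l < k) where

    swapHalves : Subset (r + r) → Subset (r + r)
    swapHalves c = drop r c ++ᵛ take r c

    take-++ : ∀ (x y : Subset r) → take r (x ++ᵛ y) ≡ x
    take-++ x y = sym (Vec.++-injectiveˡ x _ (sym (Vec.take++drop≡id r (x ++ᵛ y))))

    drop-++ : ∀ (x y : Subset r) → drop r (x ++ᵛ y) ≡ y
    drop-++ x y = sym (Vec.++-injectiveʳ x _ (sym (Vec.take++drop≡id r (x ++ᵛ y))))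

    swapHalves-++ : ∀ (x y : Subset r) → swapHalves (x ++ᵛ y) ≡ y ++ᵛ x
    swapHalves-++ x y = cong₂ _++ᵛ_ (drop-++ x y) (take-++ x y)

    halves : ∀ (c : Subset (r + r)) → take r c ++ᵛ drop r c ≡ c
    halves = Vec.take++drop≡id r

    swapHalves-involutive : ∀ c → swapHalves (swapHalves c) ≡ c
    swapHalves-involutive c = trans (swapHalves-++ (drop r c) (take r c)) (halves c)

    ∣swapHalves∣ : ∀ c → ∣ swapHalves c ∣ ≡ ∣ c ∣
    ∣swapHalves∣ c = trans (∣p++q∣≡∣q++p∣ (drop r c) (take r c)) (cong ∣_∣ (halves c))

    ∣swapHalves∩swapHalves∣ : ∀ c d → ∣ swapHalves c ∩ swapHalves d ∣ ≡ ∣ c ∩ d ∣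
    ∣swapHalves∩swapHalves∣ c d = begin
      ∣ swapHalves c ∩ swapHalves d ∣
        ≡⟨ cong ∣_∣ (∩-++ (drop r c) (drop r d) (take r c) (take r d)) ⟩
      ∣ drop r c ∩ drop r d ++ᵛ take r c ∩ take r d ∣
        ≡⟨ ∣p++q∣≡∣q++p∣ (drop r c ∩ drop r d) (take r c ∩ take r d) ⟩
      ∣ take r c ∩ take r d ++ᵛ drop r c ∩ drop r d ∣
        ≡⟨ cong ∣_∣ (∩-++ (take r c) (take r d) (drop r c) (drop r d)) ⟨
      ∣ (take r c ++ᵛ drop r c) ∩ (take r d ++ᵛ drop r d) ∣
        ≡⟨ cong₂ (λ x y → ∣ x ∩ y ∣) (halves c) (halves d) ⟩
      ∣ c ∩ d ∣ ∎
      where open ≡-Reasoning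

    V : Set
    V = Point (r + r)

    σ : V → V
    σ (c , S) = swapHalves c , S

    σ-involutive : ∀ v → σ (σ v) ≡ v
    σ-involutive (c , S) = cong (_, S) (swapHalves-involutive c)

    σ-injective : ∀ {a b} → σ a ≡ σ b → a ≡ b
    σ-injective {a} {b} σa≡σb = trans (sym (σ-involutive a)) (trans (cong σ σa≡σb) (σ-involutive b))

    weight-σ : ∀ v → weight w (σ v) ≡ weight w v
    weight-σ (c , S) = cong (λ z → w * z + ∣ S ∣) (∣swapHalves∣ c)

    commonWeight-σ : ∀ a b → commonWeight w (σ a , σ b) ≡ commonWeight w (a , b)
    commonWeight-σ (c , S) (d , T) = cong (λ z → w * z + ∣ S ∩ T ∣) (∣swapHalves∩swapHalves∣ c d)

    open IsStrictTotalOrder (<ᴾ-isStrictTotalOrder {r + r}) renaming (_<?_ to _<ᴾ?_) using (compare; asym; irrefl)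

    -- Edges are stored as increasing pairs, so σ has to reorder them.
    σE : V × V → V × V
    σE (a , b) with σ a <ᴾ? σ b
    ... | yes _ = σ a , σ b
    ... | no _  = σ b , σ a

    σE-shape : ∀ a b → σE (a , b) ≡ (σ a , σ b) ⊎ σE (a , b) ≡ (σ b , σ a)
    σE-shape a b with σ a <ᴾ? σ b
    ... | yes _ = inj₁ refl
    ... | no _  = inj₂ refl

    σE-increasing : ∀ {a b} → σ a <ᴾ σ b → σE (a , b) ≡ (σ a , σ b)
    σE-increasing {a} {b} σa<σb with σ a <ᴾ? σ b
    ... | yes _ = refl
    ... | no σa≮σb = ⊥-elim (σa≮σb σa<σb)

    σE-decreasing : ∀ {a b} → σ b <ᴾ σ a → σE (a , b) ≡ (σ b , σ a)
    σE-decreasing {a} {b} σb<σa with σ a <ᴾ? σ b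
    ... | yes σa<σb = ⊥-elim (asym {σ b} {σ a} σb<σa σa<σb)
    ... | no _ = refl

    σE-cases : ∀ {a b} → a <ᴾ b →
      (σ a <ᴾ σ b × σE (a , b) ≡ (σ a , σ b)) ⊎ (σ b <ᴾ σ a × σE (a , b) ≡ (σ b , σ a))
    σE-cases {a} {b} a<b = by-comparison (compare (σ a) (σ b))
      where
      by-comparison : Tri (σ a <ᴾ σ b) (σ a ≡ σ b) (σ b <ᴾ σ a) →
        (σ a <ᴾ σ b × σE (a , b) ≡ (σ a , σ b)) ⊎ (σ b <ᴾ σ a × σE (a , b) ≡ (σ b , σ a))
      by-comparison (tri< σa<σb _ _) = inj₁ (σa<σb , σE-increasing {a} {b} σa<σb)
      by-comparison (tri≈ _ σa≡σb _) = ⊥-elim (irrefl (σ-injective σa≡σb) a<b)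
      by-comparison (tri> _ _ σb<σa) = inj₂ (σb<σa , σE-decreasing {a} {b} σb<σa)

    σσ-<ᴾ : ∀ {a b} → a <ᴾ b → σ (σ a) <ᴾ σ (σ b)
    σσ-<ᴾ {a} {b} = subst₂ _<ᴾ_ (sym (σ-involutive a)) (sym (σ-involutive b))

    σE-involutive : ∀ {a b} → a <ᴾ b → σE (σE (a , b)) ≡ (a , b)
    σE-involutive {a} {b} a<b with σE-cases a<b
    ... | inj₁ (_ , eq) =
      trans (cong σE eq) (trans (σE-increasing {σ a} {σ b} (σσ-<ᴾ {a} {b} a<b)) (cong₂ _,_ (σ-involutive a) (σ-involutive b)))
    ... | inj₂ (_ , eq) =
      trans (cong σE eq) (trans (σE-decreasing {σ b} {σ a} (σσ-<ᴾ {a} {b} a<b)) (cong₂ _,_ (σ-involutive a) (σ-involutive b)))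

    vs : List V
    vs = vertexList w (r + r)

    es : List (V × V)
    es = edgeList w (r + r)

    σ-∈vertexList : ∀ {v} → v ∈ vs → σ v ∈ vs
    σ-∈vertexList {v} v∈ = ∈-vertexList⁺ w (σ v) (trans (weight-σ v) (∈-vertexList⁻ w v∈))

    σE-∈edgeList : ∀ {e} → e ∈ es → σE e ∈ es
    σE-∈edgeList {a , b} e∈ with ∈-edgeList⁻ w e∈
    ... | a∈ , b∈ , a<b , common≤l with σE-cases a<b
    ...   | inj₁ (σa<σb , eq) = subst (_∈ es) (sym eq)
      (∈-edgeList⁺ w (σ-∈vertexList a∈) (σ-∈vertexList b∈) σa<σb (subst (_≤ l) (sym (commonWeight-σ a b)) common≤l))
    ...   | inj₂ (σb<σa , eq) = subst (_∈ es) (sym eq)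
      (∈-edgeList⁺ w (σ-∈vertexList b∈) (σ-∈vertexList a∈) σb<σa
        (subst (_≤ l) (sym (trans (commonWeight-σ b a) (commonWeight-comm w a b))) common≤l))

    edge-increasing : ∀ {e} → e ∈ es → proj₁ e <ᴾ proj₂ e
    edge-increasing {a , b} e∈ = proj₁ (proj₂ (proj₂ (∈-edgeList⁻ w e∈)))

    -- v and σ v share S and the common part of the two halves of c, which weighs at least k − w r.
    mirror-not-adjacent : ∀ {v} → v ∈ vs → l < commonWeight w (v , σ v)
    mirror-not-adjacent {c , S} v∈ = +-cancelʳ-< (w * r) l (commonWeight w ((c , S) , σ (c , S))) (begin-strict
        l + w * r                                         ≡⟨ +-comm l (w * r) ⟩
        w * r + l                                         <⟨ w*r+l<k ⟩
        k                                                 ≡⟨ ∈-vertexList⁻ w v∈ ⟨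
        w * ∣ c ∣ + ∣ S ∣                                 ≡⟨ cong (λ z → w * ∣ z ∣ + ∣ S ∣) (halves c) ⟨
        w * ∣ x ++ᵛ y ∣ + ∣ S ∣                           ≡⟨ cong (λ z → w * z + ∣ S ∣) (∣p++q∣≡∣p∣+∣q∣ x y) ⟩
        w * (∣ x ∣ + ∣ y ∣) + ∣ S ∣                       ≤⟨ +-monoˡ-≤ ∣ S ∣ (*-monoʳ-≤ w (∣p∣+∣q∣≤∣p∩q∣+∣q∩p∣+n x y)) ⟩
        w * ((∣ x ∩ y ∣ + ∣ y ∩ x ∣) + r) + ∣ S ∣          ≡⟨ rearrange w (∣ x ∩ y ∣ + ∣ y ∩ x ∣) r ∣ S ∣ ⟩
        (w * (∣ x ∩ y ∣ + ∣ y ∩ x ∣) + ∣ S ∣) + w * r      ≡⟨ cong (_+ w * r) mirror-common ⟨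
        commonWeight w ((c , S) , σ (c , S)) + w * r       ∎)
      where
      open ≤-Reasoning
      x = take r c
      y = drop r c
      rearrange : ∀ w a r s → w * (a + r) + s ≡ (w * a + s) + w * r
      rearrange = solve 4 (λ w a r s → w :* (a :+ r) :+ s := (w :* a :+ s) :+ w :* r) refl
      mirror-common : commonWeight w ((c , S) , σ (c , S)) ≡ w * (∣ x ∩ y ∣ + ∣ y ∩ x ∣) + ∣ S ∣
      mirror-common = cong₂ (λ a b → w * a + b)
        (trans (cong (λ z → ∣ z ∩ (y ++ᵛ x) ∣) (sym (halves c)))
               (trans (cong ∣_∣ (∩-++ x y y x)) (∣p++q∣≡∣p∣+∣q∣ (x ∩ y) (y ∩ x))))
        (cong ∣_∣ (∩-idem S))

    module M = Mirror _≟ᴾ_ σ σ-involutive σE σE-shape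

    symmetric : M.Symmetric vs es
    symmetric = record
      { permutes-vertices = unique-↭ (vertexList-unique w (r + r)) (Unique.map⁺ σ-injective (vertexList-unique w (r + r)))
          (λ {v} v∈ → subst (_∈ map σ vs) (σ-involutive v) (∈-map⁺ σ (σ-∈vertexList v∈)))
          (λ v∈ → let (u , u∈ , v≡σu) = ∈-map⁻ σ v∈ in subst (_∈ vs) (sym v≡σu) (σ-∈vertexList u∈))
      ; permutes-edges = unique-↭ (edgeList-unique w (r + r)) (map-unique-local σE σE-injective-on (edgeList-unique w (r + r)))
          (λ { {a , b} e∈ → subst (_∈ map σE es) (σE-involutive (edge-increasing e∈)) (∈-map⁺ σE (σE-∈edgeList e∈)) })
          (λ e∈ → let (e′ , e′∈ , e≡σEe′) = ∈-map⁻ σE e∈ in subst (_∈ es) (sym e≡σEe′) (σE-∈edgeList e′∈))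
      ; σE-involutive = λ { {a , b} e∈ → σE-involutive (edge-increasing e∈) }
      ; fixed-edge-ends = λ { {a , b} e∈ fixed → fixed-ends e∈ fixed } }
      where
      σE-injective-on : ∀ {e e′} → e ∈ es → e′ ∈ es → σE e ≡ σE e′ → e ≡ e′
      σE-injective-on {a , b} {a′ , b′} e∈ e′∈ eq =
        trans (sym (σE-involutive (edge-increasing e∈))) (trans (cong σE eq) (σE-involutive (edge-increasing e′∈)))
      fixed-ends : ∀ {a b} → (a , b) ∈ es → σE (a , b) ≡ (a , b) → σ a ≡ a × σ b ≡ b
      fixed-ends {a} {b} e∈ fixed with ∈-edgeList⁻ w e∈ | σE-cases (edge-increasing e∈)
      ... | _ | inj₁ (_ , eq) = ,-injective (trans (sym eq) fixed)
      ... | a∈ , _ , _ , common≤l | inj₂ (_ , eq) =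
        ⊥-elim (<⇒≱ (mirror-not-adjacent a∈) (subst (λ z → commonWeight w (a , z) ≤ l) b≡σa common≤l))
        where
        b≡σa : b ≡ σ a
        b≡σa = trans (sym (σ-involutive b)) (cong σ (proj₁ (,-injective (trans (sym eq) fixed))))

    double : Point r → V
    double (d , S) = d ++ᵛ d , S

    double-injective : ∀ {u u′} → double u ≡ double u′ → u ≡ u′
    double-injective {d , S} {d′ , S′} eq with ,-injective eq
    ... | dd≡d′d′ , S≡S′ = cong₂ _,_ (Vec.++-injectiveˡ d d′ dd≡d′d′) S≡S′

    σ-double : ∀ u → σ (double u) ≡ double u
    σ-double (d , S) = cong (_, S) (swapHalves-++ d d)

    fixed⇒double : ∀ v → σ v ≡ v → Σ[ u ∈ Point r ] v ≡ double u
    fixed⇒double (c , S) fixed = (take r c , S) , cong (_, S) (trans (sym (halves c)) (cong (take r c ++ᵛ_) drop≡take))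
      where
      drop≡take : drop r c ≡ take r c
      drop≡take = Vec.++-injectiveˡ (drop r c) (take r c) (trans (proj₁ (,-injective fixed)) (sym (halves c)))

    w*[a+a]≡[w+w]*a : ∀ a → w * (a + a) ≡ (w + w) * a
    w*[a+a]≡[w+w]*a a = trans (*-distribˡ-+ w a a) (sym (*-distribʳ-+ a w w))

    weight-double : ∀ u → weight w (double u) ≡ weight (w + w) u
    weight-double (d , S) = cong (_+ ∣ S ∣) (trans (cong (w *_) (∣p++q∣≡∣p∣+∣q∣ d d)) (w*[a+a]≡[w+w]*a ∣ d ∣))

    commonWeight-double : ∀ a b → commonWeight w (double a , double b) ≡ commonWeight (w + w) (a , b)
    commonWeight-double (d , S) (e , T) = cong (_+ ∣ S ∩ T ∣) (begin
      w * ∣ (d ++ᵛ d) ∩ (e ++ᵛ e) ∣  ≡⟨ cong (λ z → w * ∣ z ∣) (∩-++ d e d e) ⟩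
      w * ∣ d ∩ e ++ᵛ d ∩ e ∣        ≡⟨ cong (w *_) (∣p++q∣≡∣p∣+∣q∣ (d ∩ e) (d ∩ e)) ⟩
      w * (∣ d ∩ e ∣ + ∣ d ∩ e ∣)    ≡⟨ w*[a+a]≡[w+w]*a ∣ d ∩ e ∣ ⟩
      (w + w) * ∣ d ∩ e ∣            ∎)
      where open ≡-Reasoning

    double-mono : ∀ {a b} → a <ᴾ b → double a <ᴾ double b
    double-mono {d , S} {e , T} (inj₁ d≺e) = inj₁ (≺-++ˡ {x = d} {e} d≺e)
    double-mono {d , S} {e , T} (inj₂ (refl , S≺T)) = inj₂ (refl , S≺T)

    double-reflects : ∀ {a b} → double a <ᴾ double b → a <ᴾ b
    double-reflects {a} {b} =
      monotone-reflects <ᴾ-isStrictTotalOrder <ᴾ-isStrictTotalOrder double (λ {a} {b} → double-mono {a} {b}) {a} {b}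

    module R = Relabel _≟ᴾ_ _≟ᴾ_ double double-injective

    vs′ : List (Point r)
    vs′ = vertexList (w + w) r

    es′ : List (Point r × Point r)
    es′ = edgeList (w + w) r

    double-∈vertexList : ∀ {u} → u ∈ vs′ → double u ∈ vs
    double-∈vertexList {u} u∈ = ∈-vertexList⁺ w (double u) (trans (weight-double u) (∈-vertexList⁻ (w + w) u∈))

    double-∈vertexList⁻ : ∀ {u} → double u ∈ vs → u ∈ vs′
    double-∈vertexList⁻ {u} du∈ = ∈-vertexList⁺ (w + w) u (trans (sym (weight-double u)) (∈-vertexList⁻ w du∈))

    doubles↭fixedVertices : map double vs′ ↭ M.fixedVertices vs
    doubles↭fixedVertices = unique-↭ (Unique.map⁺ double-injective (vertexList-unique (w + w) r))
      (Unique.filter⁺ _ (vertexList-unique w (r + r))) doubles⊆ ⊆doubles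
      where
      doubles⊆ : ∀ {v} → v ∈ map double vs′ → v ∈ M.fixedVertices vs
      doubles⊆ v∈ with ∈-map⁻ double v∈
      ... | u , u∈ , refl = ∈-filter⁺ _ (double-∈vertexList u∈) (σ-double u)
      ⊆doubles : ∀ {v} → v ∈ M.fixedVertices vs → v ∈ map double vs′
      ⊆doubles {v} v∈ with ∈-filter⁻ (λ v → σ v ≟ᴾ v) {xs = vs} v∈
      ... | v∈vs , fixed with fixed⇒double v fixed
      ...   | u , refl = ∈-map⁺ double (double-∈vertexList⁻ {u} v∈vs)

    doubles↭fixedEdges : map R.mapEdge es′ ↭ M.fixedEdges es
    doubles↭fixedEdges = unique-↭ (Unique.map⁺ R.mapEdge-injective (edgeList-unique (w + w) r))
      (Unique.filter⁺ _ (edgeList-unique w (r + r))) doubles⊆ ⊆doubles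
      where
      doubles⊆ : ∀ {e} → e ∈ map R.mapEdge es′ → e ∈ M.fixedEdges es
      doubles⊆ e∈ with ∈-map⁻ R.mapEdge e∈
      ... | (a , b) , ab∈ , refl with ∈-edgeList⁻ (w + w) ab∈
      ...   | a∈ , b∈ , a<b , common≤l = ∈-filter⁺ _
        (∈-edgeList⁺ w (double-∈vertexList a∈) (double-∈vertexList b∈) (double-mono {a} {b} a<b)
          (subst (_≤ l) (sym (commonWeight-double a b)) common≤l))
        (trans (σE-increasing {double a} {double b} (subst₂ _<ᴾ_ (sym (σ-double a)) (sym (σ-double b)) (double-mono {a} {b} a<b)))
               (cong₂ _,_ (σ-double a) (σ-double b)))
      ⊆doubles : ∀ {e} → e ∈ M.fixedEdges es → e ∈ map R.mapEdge es′
      ⊆doubles {a , b} e∈ with ∈-filter⁻ (λ e → σE e M.≟E e) {xs = es} e∈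
      ... | e∈es , fixed with ∈-edgeList⁻ w e∈es | M.Symmetric.fixed-edge-ends symmetric e∈es fixed
      ...   | a∈ , b∈ , a<b , common≤l | σa≡a , σb≡b with fixed⇒double a σa≡a | fixed⇒double b σb≡b
      ...     | a′ , refl | b′ , refl = ∈-map⁺ R.mapEdge (∈-edgeList⁺ (w + w)
        (double-∈vertexList⁻ a∈) (double-∈vertexList⁻ b∈) (double-reflects {a′} {b′} a<b)
        (subst (_≤ l) (commonWeight-double a′ b′) common≤l))

    nimᵂ-halve : nimᵂ w (r + r) ≡ nimᵂ (w + w) r
    nimᵂ-halve = trans (M.nim-mirror symmetric) (R.nim-iso doubles↭fixedVertices doubles↭fixedEdges)

  nimᵂ-collapse : ∀ j w → w * 2 ^ j < 2 * (k ∸ l) → nimᵂ w (2 ^ j) ≡ nimᵂ (w * 2 ^ j) 1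
  nimᵂ-collapse zero w _ = cong (λ v → nimᵂ v 1) (sym (*-identityʳ w))
  nimᵂ-collapse (suc j) w bound = begin
      nimᵂ w (2 ^ suc j)      ≡⟨ cong (λ z → nimᵂ w (t + z)) (+-identityʳ t) ⟩
      nimᵂ w (t + t)          ≡⟨ Halving.nimᵂ-halve w t (<∸⇒+< (*-cancelˡ-< 2 (w * t) (k ∸ l) 2wt<2[k∸l])) ⟩
      nimᵂ (w + w) t          ≡⟨ nimᵂ-collapse j (w + w) (subst (_< 2 * (k ∸ l)) (sym [w+w]t≡w2^[1+j]) bound) ⟩
      nimᵂ ((w + w) * t) 1    ≡⟨ cong (λ v → nimᵂ v 1) [w+w]t≡w2^[1+j] ⟩
      nimᵂ (w * 2 ^ suc j) 1  ∎
    where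
    open ≡-Reasoning
    t = 2 ^ j
    [w+w]t≡w2^[1+j] : (w + w) * t ≡ w * (2 * t)
    [w+w]t≡w2^[1+j] = solve 2 (λ w t → (w :+ w) :* t := w :* (con 2 :* t)) refl w t
    2wt<2[k∸l] : 2 * (w * t) < 2 * (k ∸ l)
    2wt<2[k∸l] = subst (_< 2 * (k ∸ l)) (solve 2 (λ w t → w :* (con 2 :* t) := con 2 :* (w :* t)) refl w t) bound

i-j+j≡i : ∀ i j → i ℤ.- j ℤ.+ j ≡ i
i-j+j≡i i j = trans (ℤ.+-assoc i (ℤ.- j) j) (trans (cong (λ z → i ℤ.+ z) (ℤ.+-inverseˡ j)) (ℤ.+-identityʳ i))

i+j-j≡i : ∀ i j → i ℤ.+ j ℤ.- j ≡ i
i+j-j≡i i j = trans (ℤ.+-assoc i j (ℤ.- j)) (trans (cong (λ z → i ℤ.+ z) (ℤ.+-inverseʳ j)) (ℤ.+-identityʳ i))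

+[p+a]≡+a+p : ∀ p a → + (p + a) ≡ + a ℤ.+ + p
+[p+a]≡+a+p p a = trans (cong +_ (+-comm p a)) (ℤ.pos-+ a p)

+a≡k-p⇒p+a≡k : ∀ a k p → + a ≡ + k ℤ.- + p → p + a ≡ k
+a≡k-p⇒p+a≡k a k p eq =
  ℤ.+-injective (trans (+[p+a]≡+a+p p a) (trans (cong (ℤ._+ + p) eq) (i-j+j≡i (+ k) (+ p))))

p+a≡k⇒+a≡k-p : ∀ a k p → p + a ≡ k → + a ≡ + k ℤ.- + p
p+a≡k⇒+a≡k-p a k p refl = sym (trans (cong (ℤ._- + p) (+[p+a]≡+a+p p a)) (i+j-j≡i (+ a) (+ p)))

+a≤l-p⇒p+a≤l : ∀ a l p → + a ℤ.≤ + l ℤ.- + p → p + a ≤ l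
+a≤l-p⇒p+a≤l a l p a≤l-p =
  ℤ.drop‿+≤+ (subst₂ ℤ._≤_ (sym (+[p+a]≡+a+p p a)) (i-j+j≡i (+ l) (+ p)) (ℤ.+-monoˡ-≤ (+ p) a≤l-p))

p+a≤l⇒+a≤l-p : ∀ a l p → p + a ≤ l → + a ℤ.≤ + l ℤ.- + p
p+a≤l⇒+a≤l-p a l p p+a≤l =
  subst (ℤ._≤ + l ℤ.- + p) (trans (cong (ℤ._- + p) (+[p+a]≡+a+p p a)) (i+j-j≡i (+ a) (+ p)))
    (ℤ.+-monoˡ-≤ (ℤ.- + p) (+≤+ p+a≤l))

module Kneser (n : ℕ) (K L : ℤ) where

  vertices-sorted : AllPairs _≺_ (vertices (KG n K L))
  vertices-sorted = AllPairs.filter⁺ _ (allSubsets-sorted n)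

  vertices-unique : Unique (vertices (KG n K L))
  vertices-unique = sorted⇒unique ≺-isStrictTotalOrder vertices-sorted

  edges-unique : Unique (edges (KG n K L))
  edges-unique = Unique.filter⁺ _ (pairs-unique vertices-unique)

  ∈-vertices⁺ : ∀ s → + ∣ s ∣ ≡ K → s ∈ vertices (KG n K L)
  ∈-vertices⁺ s ∣s∣≡K = ∈-filter⁺ _ (∈-allSubsets s) ∣s∣≡K

  ∈-vertices⁻ : ∀ {s} → s ∈ vertices (KG n K L) → + ∣ s ∣ ≡ K
  ∈-vertices⁻ s∈ = proj₂ (∈-filter⁻ (λ s → (+ ∣ s ∣) ℤ.≟ K) {xs = allSubsets n} s∈)

  ∈-edges⁺ : ∀ {a b} → a ∈ vertices (KG n K L) → b ∈ vertices (KG n K L) → a ≺ b → + ∣ a ∩ b ∣ ℤ.≤ L →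
    (a , b) ∈ edges (KG n K L)
  ∈-edges⁺ a∈ b∈ a≺b meet≤L = ∈-filter⁺ _ (pairs⁺ ≺-isStrictTotalOrder vertices-sorted a∈ b∈ a≺b) meet≤L

  ∈-edges⁻ : ∀ {a b} → (a , b) ∈ edges (KG n K L) →
    a ∈ vertices (KG n K L) × b ∈ vertices (KG n K L) × a ≺ b × + ∣ a ∩ b ∣ ℤ.≤ L
  ∈-edges⁻ e∈ with ∈-filter⁻ (λ e → (+ ∣ proj₁ e ∩ proj₂ e ∣) ℤ.≤? L) {xs = pairs (vertices (KG n K L))} e∈
  ... | e∈pairs , meet≤L with pairs⁻ ≺-isStrictTotalOrder vertices-sorted e∈pairs
  ...   | a∈ , b∈ , a≺b = a∈ , b∈ , a≺b , meet≤L

module Concatenation (n k l P : ℕ) where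
  open Weighted n k l
  private
    module K = Kneser (P + n) (+ k) (+ l)
    G : Graph
    G = KG (P + n) (+ k) (+ l)

  concatᴾ : Point P → Subset (P + n)
  concatᴾ (c , S) = c ++ᵛ S

  concatᴾ-injective : ∀ {a b} → concatᴾ a ≡ concatᴾ b → a ≡ b
  concatᴾ-injective {c , S} {d , T} eq = cong₂ _,_ (Vec.++-injectiveˡ c d eq) (Vec.++-injectiveʳ c d eq)

  concatᴾ-surjective : ∀ s → Σ[ u ∈ Point P ] s ≡ concatᴾ u
  concatᴾ-surjective s with splitAt P s
  ... | c , S , s≡c++S = (c , S) , s≡c++S

  concatᴾ-mono : ∀ {a b} → a <ᴾ b → concatᴾ a ≺ concatᴾ b
  concatᴾ-mono {c , S} {d , T} (inj₁ c≺d) = ≺-++ˡ {x = c} {d} c≺d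
  concatᴾ-mono {c , S} {d , T} (inj₂ (refl , S≺T)) = ≺-++ʳ c S≺T

  concatᴾ-reflects : ∀ {a b} → concatᴾ a ≺ concatᴾ b → a <ᴾ b
  concatᴾ-reflects {a} {b} =
    monotone-reflects <ᴾ-isStrictTotalOrder ≺-isStrictTotalOrder concatᴾ (λ {a} {b} → concatᴾ-mono {a} {b}) {a} {b}

  ∣concatᴾ∣ : ∀ u → ∣ concatᴾ u ∣ ≡ weight 1 u
  ∣concatᴾ∣ (c , S) = trans (∣p++q∣≡∣p∣+∣q∣ c S) (cong (_+ ∣ S ∣) (sym (*-identityˡ ∣ c ∣)))

  ∣concatᴾ∩concatᴾ∣ : ∀ a b → ∣ concatᴾ a ∩ concatᴾ b ∣ ≡ commonWeight 1 (a , b)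
  ∣concatᴾ∩concatᴾ∣ (c , S) (d , T) =
    trans (cong ∣_∣ (∩-++ c d S T)) (∣concatᴾ∣ (c ∩ d , S ∩ T))

  concatᴾ-∈vertices : ∀ {u} → u ∈ vertexList 1 P → concatᴾ u ∈ vertices G
  concatᴾ-∈vertices {u} u∈ = K.∈-vertices⁺ (concatᴾ u) (cong +_ (trans (∣concatᴾ∣ u) (∈-vertexList⁻ 1 u∈)))

  concatᴾ-∈vertices⁻ : ∀ {u} → concatᴾ u ∈ vertices G → u ∈ vertexList 1 P
  concatᴾ-∈vertices⁻ {u} u∈ = ∈-vertexList⁺ 1 u (trans (sym (∣concatᴾ∣ u)) (ℤ.+-injective (K.∈-vertices⁻ u∈)))

  module R = Relabel _≟ᴾ_ (_≟V_ G) concatᴾ concatᴾ-injective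

  concatᴾ↭vertices : map concatᴾ (vertexList 1 P) ↭ vertices G
  concatᴾ↭vertices = map-↭ concatᴾ-injective (vertexList-unique 1 P) K.vertices-unique concatᴾ-∈vertices preimage
    where
    preimage : ∀ {s} → s ∈ vertices G → Σ[ u ∈ Point P ] u ∈ vertexList 1 P × s ≡ concatᴾ u
    preimage {s} s∈ with concatᴾ-surjective s
    ... | u , refl = u , concatᴾ-∈vertices⁻ s∈ , refl

  concatᴾ↭edges : map R.mapEdge (edgeList 1 P) ↭ edges G
  concatᴾ↭edges = map-↭ R.mapEdge-injective (edgeList-unique 1 P) K.edges-unique image preimage
    where
    image : ∀ {e} → e ∈ edgeList 1 P → R.mapEdge e ∈ edges G
    image {a , b} e∈ with ∈-edgeList⁻ 1 e∈
    ... | a∈ , b∈ , a<b , common≤l = K.∈-edges⁺ (concatᴾ-∈vertices a∈) (concatᴾ-∈vertices b∈)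
      (concatᴾ-mono {a} {b} a<b) (+≤+ (subst (_≤ l) (sym (∣concatᴾ∩concatᴾ∣ a b)) common≤l))
    preimage : ∀ {e} → e ∈ edges G → Σ[ e′ ∈ Point P × Point P ] e′ ∈ edgeList 1 P × e ≡ R.mapEdge e′
    preimage {s , t} e∈ with concatᴾ-surjective s | concatᴾ-surjective t | K.∈-edges⁻ e∈
    ... | a , refl | b , refl | a∈ , b∈ , a≺b , meet≤l = (a , b) , ∈-edgeList⁺ 1
      (concatᴾ-∈vertices⁻ a∈) (concatᴾ-∈vertices⁻ b∈) (concatᴾ-reflects {a} {b} a≺b)
      (subst (_≤ l) (∣concatᴾ∩concatᴾ∣ a b) (ℤ.drop‿+≤+ meet≤l)) , refl

  Nim-KG≡nimᵂ : Nim (KG (P + n) (+ k) (+ l)) ≡ nimᵂ 1 P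
  Nim-KG≡nimᵂ = R.nim-iso concatᴾ↭vertices concatᴾ↭edges

module Splitting (n k l P : ℕ) (k∸l≤P : k ∸ l ≤ P) where
  open Weighted n k l
  private
    module K₁ = Kneser n (+ k) (+ l)
    module K₂ = Kneser n (+ k ℤ.- + P) (+ l ℤ.- + P)
    G₁ G₂ G : Graph
    G₁ = KG n (+ k) (+ l)
    G₂ = KG n (+ k ℤ.- + P) (+ l ℤ.- + P)
    G = G₁ +G G₂

  tag : Subset n ⊎ Subset n → Point 1
  tag (inj₁ S) = false ∷ [] , S
  tag (inj₂ S) = true ∷ [] , S

  tag-injective : ∀ {x y} → tag x ≡ tag y → x ≡ y
  tag-injective {inj₁ S} {inj₁ T} eq = cong inj₁ (proj₂ (,-injective eq))
  tag-injective {inj₂ S} {inj₂ T} eq = cong inj₂ (proj₂ (,-injective eq))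

  module R = Relabel (_≟V_ G) _≟ᴾ_ tag tag-injective

  inj₁₁ inj₂₂ inj₁₂ : Subset n × Subset n → Vtx G × Vtx G
  inj₁₁ e = inj₁ (proj₁ e) , inj₁ (proj₂ e)
  inj₂₂ e = inj₂ (proj₁ e) , inj₂ (proj₂ e)
  inj₁₂ e = inj₁ (proj₁ e) , inj₂ (proj₂ e)

  weight-inj₁ : ∀ S → weight P (tag (inj₁ S)) ≡ ∣ S ∣
  weight-inj₁ S = cong (_+ ∣ S ∣) (*-zeroʳ P)

  weight-inj₂ : ∀ S → weight P (tag (inj₂ S)) ≡ P + ∣ S ∣
  weight-inj₂ S = cong (_+ ∣ S ∣) (*-identityʳ P)

  inj₁-∈vertexList : ∀ {S} → S ∈ vertices G₁ → tag (inj₁ S) ∈ vertexList P 1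
  inj₁-∈vertexList {S} S∈ = ∈-vertexList⁺ P _ (trans (weight-inj₁ S) (ℤ.+-injective (K₁.∈-vertices⁻ S∈)))

  inj₂-∈vertexList : ∀ {S} → S ∈ vertices G₂ → tag (inj₂ S) ∈ vertexList P 1
  inj₂-∈vertexList {S} S∈ = ∈-vertexList⁺ P _ (trans (weight-inj₂ S) (+a≡k-p⇒p+a≡k ∣ S ∣ k P (K₂.∈-vertices⁻ S∈)))

  inj₁-∈vertexList⁻ : ∀ {S} → tag (inj₁ S) ∈ vertexList P 1 → S ∈ vertices G₁
  inj₁-∈vertexList⁻ {S} S∈ = K₁.∈-vertices⁺ S (cong +_ (trans (sym (weight-inj₁ S)) (∈-vertexList⁻ P S∈)))

  inj₂-∈vertexList⁻ : ∀ {S} → tag (inj₂ S) ∈ vertexList P 1 → S ∈ vertices G₂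
  inj₂-∈vertexList⁻ {S} S∈ = K₂.∈-vertices⁺ S (p+a≡k⇒+a≡k-p ∣ S ∣ k P (trans (sym (weight-inj₂ S)) (∈-vertexList⁻ P S∈)))

  -- A vertex T of G₂ has ∣ T ∣ = k − P ≤ l, so it is adjacent to every vertex of G₁.
  cross-commonWeight≤l : ∀ S {T} → T ∈ vertices G₂ → commonWeight P (tag (inj₁ S) , tag (inj₂ T)) ≤ l
  cross-commonWeight≤l S {T} T∈ = begin
      P * 0 + ∣ S ∩ T ∣  ≡⟨ cong (_+ ∣ S ∩ T ∣) (*-zeroʳ P) ⟩
      ∣ S ∩ T ∣          ≤⟨ ∣p∩q∣≤∣q∣ S T ⟩
      ∣ T ∣              ≤⟨ +-cancelˡ-≤ P ∣ T ∣ l P+∣T∣≤P+l ⟩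
      l                  ∎
    where
    open ≤-Reasoning
    P+∣T∣≤P+l : P + ∣ T ∣ ≤ P + l
    P+∣T∣≤P+l = begin
      P + ∣ T ∣  ≡⟨ +a≡k-p⇒p+a≡k ∣ T ∣ k P (K₂.∈-vertices⁻ T∈) ⟩
      k          ≤⟨ m≤n+m∸n k l ⟩
      l + (k ∸ l) ≤⟨ +-monoʳ-≤ l k∸l≤P ⟩
      l + P      ≡⟨ +-comm l P ⟩
      P + l      ∎

  join-vertices-unique : Unique (vertices G)
  join-vertices-unique = Unique.++⁺ (Unique.map⁺ Sum.inj₁-injective K₁.vertices-unique)
    (Unique.map⁺ Sum.inj₂-injective K₂.vertices-unique) (map-disjoint λ ())

  join-edges-unique : Unique (edges G)
  join-edges-unique = Unique.++⁺ (Unique.map⁺ inj₁₁-injective K₁.edges-unique)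
    (Unique.++⁺ (Unique.map⁺ inj₂₂-injective K₂.edges-unique) (Unique.map⁺ inj₁₂-injective cross-unique)
                (map-disjoint λ ()))
    λ { (v∈₁ , v∈₂₃) → [ (λ v∈₂ → map-disjoint (λ ()) (v∈₁ , v∈₂)) , (λ v∈₃ → map-disjoint (λ ()) (v∈₁ , v∈₃)) ]′
                          (∈-++⁻ (map inj₂₂ (edges G₂)) v∈₂₃) }
    where
    inj₁₁-injective : ∀ {e e′} → inj₁₁ e ≡ inj₁₁ e′ → e ≡ e′
    inj₁₁-injective {a , b} {a′ , b′} refl = refl
    inj₂₂-injective : ∀ {e e′} → inj₂₂ e ≡ inj₂₂ e′ → e ≡ e′
    inj₂₂-injective {a , b} {a′ , b′} refl = refl
    inj₁₂-injective : ∀ {e e′} → inj₁₂ e ≡ inj₁₂ e′ → e ≡ e′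
    inj₁₂-injective {a , b} {a′ , b′} refl = refl
    cross-unique : Unique (pairsWith (vertices G₁) (vertices G₂))
    cross-unique = subst Unique (sym (pairsWith≡cartesianProduct (vertices G₁) (vertices G₂)))
      (Unique.cartesianProduct⁺ K₁.vertices-unique K₂.vertices-unique)

  tag↭vertices : map tag (vertices G) ↭ vertexList P 1
  tag↭vertices = map-↭ tag-injective join-vertices-unique (vertexList-unique P 1) image preimage
    where
    image : ∀ {x} → x ∈ vertices G → tag x ∈ vertexList P 1
    image x∈ with ∈-++⁻ (map inj₁ (vertices G₁)) x∈
    ... | inj₁ x∈₁ with ∈-map⁻ inj₁ x∈₁
    ...   | S , S∈ , refl = inj₁-∈vertexList S∈
    image x∈ | inj₂ x∈₂ with ∈-map⁻ inj₂ x∈₂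
    ...   | S , S∈ , refl = inj₂-∈vertexList S∈
    preimage : ∀ {v} → v ∈ vertexList P 1 → Σ[ x ∈ Subset n ⊎ Subset n ] x ∈ vertices G × v ≡ tag x
    preimage {false ∷ [] , S} v∈ = inj₁ S , ∈-++⁺ˡ (∈-map⁺ inj₁ (inj₁-∈vertexList⁻ v∈)) , refl
    preimage {true ∷ [] , S} v∈ = inj₂ S , ∈-++⁺ʳ (map inj₁ (vertices G₁)) (∈-map⁺ inj₂ (inj₂-∈vertexList⁻ v∈)) , refl

  tag↭edges : map R.mapEdge (edges G) ↭ edgeList P 1
  tag↭edges = map-↭ R.mapEdge-injective join-edges-unique (edgeList-unique P 1) image preimage
    where
    image : ∀ {e} → e ∈ edges G → R.mapEdge e ∈ edgeList P 1
    image e∈ with ∈-++⁻ (map inj₁₁ (edges G₁)) e∈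
    ... | inj₁ e∈₁ with ∈-map⁻ _ e∈₁
    ...   | (a , b) , ab∈ , refl with K₁.∈-edges⁻ ab∈
    ...     | a∈ , b∈ , a≺b , meet≤l = ∈-edgeList⁺ P (inj₁-∈vertexList a∈) (inj₁-∈vertexList b∈) (inj₂ (refl , a≺b))
      (subst (_≤ l) (sym (weight-inj₁ (a ∩ b))) (ℤ.drop‿+≤+ meet≤l))
    image e∈ | inj₂ e∈₂₃ with ∈-++⁻ (map inj₂₂ (edges G₂)) e∈₂₃
    ... | inj₁ e∈₂ with ∈-map⁻ _ e∈₂
    ...   | (a , b) , ab∈ , refl with K₂.∈-edges⁻ ab∈
    ...     | a∈ , b∈ , a≺b , meet≤l-P = ∈-edgeList⁺ P (inj₂-∈vertexList a∈) (inj₂-∈vertexList b∈) (inj₂ (refl , a≺b))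
      (subst (_≤ l) (sym (weight-inj₂ (a ∩ b))) (+a≤l-p⇒p+a≤l ∣ a ∩ b ∣ l P meet≤l-P))
    image e∈ | inj₂ e∈₂₃ | inj₂ e∈₃ with ∈-map⁻ _ e∈₃
    ...   | (a , b) , ab∈ , refl with ∈-cartesianProduct⁻ (vertices G₁) (vertices G₂)
                                       (subst ((a , b) ∈_) (pairsWith≡cartesianProduct (vertices G₁) (vertices G₂)) ab∈)
    ...     | a∈ , b∈ = ∈-edgeList⁺ P (inj₁-∈vertexList a∈) (inj₂-∈vertexList b∈) (inj₁ tt) (cross-commonWeight≤l a b∈)
    preimage : ∀ {e} → e ∈ edgeList P 1 → Σ[ e′ ∈ (Subset n ⊎ Subset n) × (Subset n ⊎ Subset n) ] e′ ∈ edges G × e ≡ R.mapEdge e′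
    preimage {(c , S) , (d , T)} e∈ with ∈-edgeList⁻ P e∈
    preimage {(false ∷ [] , S) , (false ∷ [] , T)} e∈ | S∈ , T∈ , inj₂ (refl , S≺T) , common≤l =
      (inj₁ S , inj₁ T) , ∈-++⁺ˡ (∈-map⁺ inj₁₁ (K₁.∈-edges⁺ (inj₁-∈vertexList⁻ S∈) (inj₁-∈vertexList⁻ T∈) S≺T
        (+≤+ (subst (_≤ l) (weight-inj₁ (S ∩ T)) common≤l)))) , refl
    preimage {(true ∷ [] , S) , (true ∷ [] , T)} e∈ | S∈ , T∈ , inj₂ (refl , S≺T) , common≤l =
      (inj₂ S , inj₂ T) , ∈-++⁺ʳ (map inj₁₁ (edges G₁)) (∈-++⁺ˡ (∈-map⁺ inj₂₂ (K₂.∈-edges⁺ (inj₂-∈vertexList⁻ S∈) (inj₂-∈vertexList⁻ T∈) S≺T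
        (p+a≤l⇒+a≤l-p ∣ S ∩ T ∣ l P (subst (_≤ l) (weight-inj₂ (S ∩ T)) common≤l))))) , refl
    preimage {(false ∷ [] , S) , (true ∷ [] , T)} e∈ | S∈ , T∈ , _ , _ =
      (inj₁ S , inj₂ T) , ∈-++⁺ʳ (map inj₁₁ (edges G₁)) (∈-++⁺ʳ (map inj₂₂ (edges G₂)) (∈-map⁺ inj₁₂ (subst ((S , T) ∈_)
        (sym (pairsWith≡cartesianProduct (vertices G₁) (vertices G₂)))
        (∈-cartesianProduct⁺ (inj₁-∈vertexList⁻ S∈) (inj₂-∈vertexList⁻ T∈))))) , refl
    preimage {(false ∷ [] , S) , (false ∷ [] , T)} e∈ | _ , _ , inj₁ () , _
    preimage {(true ∷ [] , S) , (true ∷ [] , T)} e∈ | _ , _ , inj₁ () , _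
    preimage {(true ∷ [] , S) , (false ∷ [] , T)} e∈ | _ , _ , inj₁ () , _
    preimage {(true ∷ [] , S) , (false ∷ [] , T)} e∈ | _ , _ , inj₂ (() , _) , _

  nimᵂ≡Nim-join : nimᵂ P 1 ≡ Nim (KG n (+ k) (+ l) +G KG n (+ k ℤ.- + P) (+ l ℤ.- + P))
  nimᵂ≡Nim-join = R.nim-iso tag↭vertices tag↭edges

proposition2p9 : (n k l m : ℕ) → 2 + l ≤ k → 1 ≤ m
    → k ∸ l ≤ 2 ^ m → 2 ^ m < 2 * (k ∸ l) → 2 ^ m ≤ n
    → Nim (KG n (+ k) (+ l))
      ≡ Nim (KG (n ∸ 2 ^ m) (+ k) (+ l)
             +G KG (n ∸ 2 ^ m) (+ k - + (2 ^ m)) (+ l - + (2 ^ m)))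
proposition2p9 n k l m _ _ k∸l≤2^m 2^m<2[k∸l] 2^m≤n =
  subst (λ N → Nim (KG N (+ k) (+ l)) ≡ Nim (KG n′ (+ k) (+ l) +G KG n′ (+ k - + (2 ^ m)) (+ l - + (2 ^ m))))
        (m+[n∸m]≡n 2^m≤n)
        (begin
          Nim (KG (2 ^ m + n′) (+ k) (+ l)) ≡⟨ Concatenation.Nim-KG≡nimᵂ n′ k l (2 ^ m) ⟩
          nimᵂ 1 (2 ^ m)                    ≡⟨ Weighted.nimᵂ-collapse n′ k l m 1 1*2^m<2[k∸l] ⟩
          nimᵂ (1 * 2 ^ m) 1                ≡⟨ cong (λ w → nimᵂ w 1) (*-identityˡ (2 ^ m)) ⟩
          nimᵂ (2 ^ m) 1                    ≡⟨ Splitting.nimᵂ≡Nim-join n′ k l (2 ^ m) k∸l≤2^m ⟩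
          Nim (KG n′ (+ k) (+ l) +G KG n′ (+ k - + (2 ^ m)) (+ l - + (2 ^ m))) ∎)
  where
  open ≡-Reasoning
  n′ = n ∸ 2 ^ m
  open Weighted n′ k l using (nimᵂ)
  1*2^m<2[k∸l] : 1 * 2 ^ m < 2 * (k ∸ l)
  1*2^m<2[k∸l] = subst (_< 2 * (k ∸ l)) (sym (*-identityˡ (2 ^ m))) 2^m<2[k∸l]
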